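{- For all integers $m \ge 2$ and $s \ge 1$, \[ y_s(m-1) = a_s(m), \] where $y_s(m-1)$ is the number of $(m-1)$-colored chain-increasing binary trees with $s$ chains, and $a_s(m)$ is the number of rooted $m$-partite labeled series-reduced trees with $s$ leaves.
   Context: A $k$-colored chain-increasing binary tree with $s$ chains is a rooted, non-planar tree in which: - every vertex has at most $2$ children; - vertices with exactly $2$ children (junctions) are unlabeled and colored with one of $k$ colors, with no adjacency restriction; - vertices with at most $1$ child (chains) are uncolored and labeled bijectively by $\{1,\dots,s\}$; - labels increase along every path from the root downward. A rooted $m$-partite labeled series-reduced tree with $s$ leaves is a rooted non-planar tree with no vertex of out-degree $1$ (the single-leaf tree is allowed), satisfying: - its leaves (out-degree $0$) are labeled bijectively by $\{1,\dots,s\}$ and are uncolored; - its inner vertices are colored from $\{1,\dots,m\}$ with adjacent inner vertices colored differently. All trees are counted up to isomorphism preserving root, labels and colors. -}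

module Defs where

open import Data.Nat using (ℕ; zero; suc; _<_; _≤_; _∸_)
open import Data.Fin using (Fin)
open import Data.List using (List; []; _∷_; _++_; map; upTo; length)
open import Data.List.Relation.Unary.All using (All)
open import Data.List.Relation.Binary.Pointwise using (Pointwise)
open import Data.List.Relation.Binary.Permutation.Propositional using (_↭_)
open import Data.Product using (Σ; _×_; ∃)
open import Data.Sum using (_⊎_)
open import Relation.Binary.PropositionalEquality using (_≡_; _≢_)

-- Generic notion: the number of isomorphism classes of objects
-- satisfying P (w.r.t. the isomorphism relation _≈_) is n.

record ClassCount {A : Set} (P : A → Set) (_≈_ : A → A → Set) (n : ℕ) : Set where
  field
    rep       : Fin n → A
    rep-ok    : ∀ i → P (rep i)
    rep-inj   : ∀ i j → rep i ≈ rep j → i ≡ j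
    rep-surj  : ∀ a → P a → Σ (Fin n) λ i → a ≈ rep i

labelSet : ℕ → List ℕ
labelSet s = map suc (upTo s)

-- k-colored chain-increasing binary trees (as raw planar terms;
-- non-planarity is handled by the isomorphism relation below).

data YTree (k : ℕ) : Set where
  chain0   : ℕ → YTree k
  chain1   : ℕ → YTree k → YTree k
  junction : Fin k → YTree k → YTree k → YTree k

ylabels : ∀ {k} → YTree k → List ℕ
ylabels (chain0 l)       = l ∷ []
ylabels (chain1 l t)     = l ∷ ylabels t
ylabels (junction c a b) = ylabels a ++ ylabels b

data YIncreasing {k : ℕ} : YTree k → Set where
  chain0   : ∀ {l} → YIncreasing (chain0 l)
  chain1   : ∀ {l t} → All (l <_) (ylabels t) → YIncreasing t →
             YIncreasing (chain1 l t)
  junction : ∀ {c a b} → YIncreasing a → YIncreasing b →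
             YIncreasing (junction c a b)

IsYTree : (k s : ℕ) → YTree k → Set
IsYTree k s t = (ylabels t ↭ labelSet s) × YIncreasing t

data _≅Y_ {k : ℕ} : YTree k → YTree k → Set where
  chain0   : ∀ {l} → chain0 l ≅Y chain0 l
  chain1   : ∀ {l t t'} → t ≅Y t' → chain1 l t ≅Y chain1 l t'
  junction : ∀ {c a b a' b'} →
             ((a ≅Y a' × b ≅Y b') ⊎ (a ≅Y b' × b ≅Y a')) →
             junction c a b ≅Y junction c a' b'

Y-count : (k s n : ℕ) → Set
Y-count k s n = ClassCount (IsYTree k s) _≅Y_ n

data STree (m : ℕ) : Set where
  leaf : ℕ → STree m
  node : Fin m → List (STree m) → STree m

mutual
  slabels : ∀ {m} → STree m → List ℕ
  slabels (leaf l)    = l ∷ []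
  slabels (node c ts) = slabelsL ts

  slabelsL : ∀ {m} → List (STree m) → List ℕ
  slabelsL []       = []
  slabelsL (t ∷ ts) = slabels t ++ slabelsL ts

data ColorDiff {m : ℕ} (c : Fin m) : STree m → Set where
  leaf : ∀ {l} → ColorDiff c (leaf l)
  node : ∀ {c' ts} → c ≢ c' → ColorDiff c (node c' ts)

data SWellFormed {m : ℕ} : STree m → Set where
  leaf : ∀ {l} → SWellFormed (leaf l)
  node : ∀ {c ts} → 2 ≤ length ts → All (ColorDiff c) ts →
         All SWellFormed ts → SWellFormed (node c ts)

IsSTree : (m s : ℕ) → STree m → Set
IsSTree m s t = (slabels t ↭ labelSet s) × SWellFormed t

data _≅S_ {m : ℕ} : STree m → STree m → Set where
  leaf : ∀ {l} → leaf l ≅S leaf l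
  node : ∀ {c ts ts'} →
         Σ (List (STree m)) (λ us → (ts ↭ us) × Pointwise _≅S_ us ts') →
         node c ts ≅S node c ts'

A-count : (m s n : ℕ) → Set
A-count m s n = ClassCount (IsSTree m s) _≅S_ n

{-# OPTIONS --safe #-}
module Submission where

-- Both numbers count the canonical chain-increasing trees with labels {1, …, s}: those in
-- which, at every junction, the first subtree holds the smaller least label.  Every
-- isomorphism class of chain-increasing trees contains exactly one of them, and toS maps
-- them bijectively onto the isomorphism classes of series-reduced trees.
--
-- toS reads a chain-increasing tree as a forest: its head tree followed by the forest of
-- the child of the chain vertex reached from the root through first subtrees, which
-- carries the least label.  The head tree is built bottom-up along that path: the chain
-- vertex becomes a leaf, and a junction of colour c becomes a vertex of colour c + 1 whose
-- children are the head tree of its first subtree and the forest of its second, recoloured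
-- by the transposition of 0 and c + 1.  No tree of a forest has a root of colour 0, so no
-- child of the new vertex has colour c + 1.  Finally the forest is put under a root of
-- colour 0, unless it is a single tree.  The inverse toY inserts the trees of a forest in
-- increasing order of their least labels; as the labels are distinct, so are these minima,
-- which makes toY invariant under isomorphism.

open import Defs
open import Data.Nat
  using (ℕ; zero; suc; _+_; _∸_; _≤_; _<_; _⊓_; z≤n; s≤s; s≤s⁻¹; z<s; _<?_)
open import Data.Nat.Properties
  using ( ≤-decTotalOrder; ≤-totalOrder; _≟_; suc-injective
        ; ≤-reflexive; ≤-refl; ≤-trans; ≤-antisym; <⇒≤; <-asym; <⇒≱; ≮⇒≥; ≤∧≢⇒<
        ; <-≤-trans; <-trans; <⇒≢; <-cmp; m<m+n; m<n+m
        ; ⊓-sel; ⊓-glb; m⊓n≤m; m⊓n≤n; m≤n⇒m⊓n≡m; m≥n⇒m⊓n≡n )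
open import Data.Fin using (Fin; zero; suc)
open import Data.Fin.Properties using () renaming (_≟_ to _≟F_)
open import Data.Fin.Permutation.Components using (transpose; transpose-inverse)
open import Data.List
  using (List; []; _∷_; _++_; length; lookup; upTo; filter; deduplicate; map; concatMap
        ; cartesianProductWith; allFin)
open import Data.List.Properties using (≡-dec; length-++-≤ˡ; length-++; length-map; length-upTo)
open import Data.List.Membership.Propositional using (_∈_; _∉_; lose)
open import Data.List.Membership.Propositional.Properties
  using ( ∈-lookup; ∈-++⁺ˡ; ∈-++⁺ʳ; ∈-map⁺; ∈-cartesianProductWith⁺; ∈-concatMap⁺
        ; ∈-allFin
        ; ∈-filter⁺; ∈-filter⁻; ∈-deduplicate⁺; ∈-deduplicate⁻ )
open import Data.List.Relation.Unary.All as All using (All; []; _∷_; all?) renaming (lookup to lookupAll)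
import Data.List.Relation.Unary.All.Properties as AllProps
open import Data.List.Relation.Unary.Any using (here; there; index)
open import Data.List.Relation.Unary.Any.Properties using (lookup-index)
open import Data.List.Relation.Unary.AllPairs using (AllPairs; []; _∷_)
open import Data.List.Relation.Unary.Unique.Propositional using (Unique)
import Data.List.Relation.Unary.Unique.Propositional.Properties as Unique
import Data.List.Relation.Unary.Unique.DecPropositional.Properties as UniqueDec
open import Data.List.Relation.Binary.Pointwise using (Pointwise; []; _∷_; Pointwise-length)
open import Data.List.Relation.Binary.Permutation.Propositional
  using (_↭_; refl; prep; swap; trans; ↭-sym; ↭-trans; ↭⇒↭ₛ; module PermutationReasoning)
open import Data.List.Relation.Binary.Permutation.Propositional.Properties
  using ( ↭-length; All-resp-↭; ∈-resp-↭; ++⁺; ++⁺ʳ; ++⁺ˡ; ++-comm; ++-assoc; ++-identityʳ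
        ; shift )
import Data.List.Relation.Binary.Permutation.Setoid.Properties as PermSetoid
open import Data.List.Relation.Binary.Equality.Propositional using (≋⇒≡)
open import Data.List.Relation.Unary.Sorted.TotalOrder.Properties using (↗↭↗⇒≋)
open import Data.List.Sort ≤-decTotalOrder using (sort; sort-↭; sort-↗)
open import Data.Product using (Σ; _×_; _,_; proj₁; proj₂)
open import Data.Sum using (inj₁; inj₂)
open import Data.Maybe using (Maybe; nothing; just; fromMaybe)
open import Data.Unit using (⊤; tt)
open import Relation.Nullary using (¬_; Dec; yes; no; contradiction)
open import Relation.Nullary.Decidable using (map′; _×-dec_; toSum)
open import Relation.Binary.Definitions using (DecidableEquality; tri<; tri≈; tri>)
open import Relation.Binary.Structures using (IsPreorder)
import Relation.Binary.Reasoning.Base.Double as PreorderReasoning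
import Relation.Binary.PropositionalEquality as ≡
open import Relation.Binary.PropositionalEquality
  using (_≡_; _≢_; _≗_; refl; sym; cong; cong₂; subst; subst₂) renaming (trans to ≡-trans)
open import Function using (_∘_; id)
open import Function.Definitions using (Injective)

-- Lists, permutations and counting by canonical representatives

Unique-++⁻ : {A : Set} (xs : List A) {ys : List A} → Unique (xs ++ ys) →
             Unique xs × Unique ys × (∀ {a} → a ∈ xs → a ∉ ys)
Unique-++⁻ []       u          = [] , u , λ ()
Unique-++⁻ (x ∷ xs) {ys} (x∉ ∷ u) with Unique-++⁻ xs u | AllProps.++⁻ xs x∉
... | uxs , uys , disjoint | x∉xs , x∉ys = x∉xs ∷ uxs , uys , disjoint′
  where
  disjoint′ : ∀ {a} → a ∈ x ∷ xs → a ∉ ys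
  disjoint′ (here refl) a∈ys = lookupAll x∉ys a∈ys refl
  disjoint′ (there a∈xs)     = disjoint a∈xs

lookup-injective : {A : Set} {xs : List A} → Unique xs →
                   ∀ i j → lookup xs i ≡ lookup xs j → i ≡ j
lookup-injective (x∉ ∷ u) zero    zero    e = refl
lookup-injective (x∉ ∷ u) zero    (suc j) e = contradiction e (lookupAll x∉ (∈-lookup j))
lookup-injective (x∉ ∷ u) (suc i) zero    e = contradiction (sym e) (lookupAll x∉ (∈-lookup i))
lookup-injective (x∉ ∷ u) (suc i) (suc j) e = cong suc (lookup-injective u i j e)

_↭?_ : (xs ys : List ℕ) → Dec (xs ↭ ys)
xs ↭? ys = map′ sorted≡⇒↭ ↭⇒sorted≡ (≡-dec _≟_ (sort xs) (sort ys))
  where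
  sorted≡⇒↭ : sort xs ≡ sort ys → xs ↭ ys
  sorted≡⇒↭ e = ↭-trans (↭-sym (sort-↭ xs)) (subst (_↭ ys) (sym e) (sort-↭ ys))
  ↭⇒sorted≡ : xs ↭ ys → sort xs ≡ sort ys
  ↭⇒sorted≡ p = ≋⇒≡ (↗↭↗⇒≋ ≤-totalOrder (sort-↗ xs) (sort-↗ ys)
    (↭⇒↭ₛ (↭-trans (sort-↭ xs) (↭-trans p (↭-sym (sort-↭ ys))))))

Unique-resp-↭ : {A : Set} {xs ys : List A} → xs ↭ ys → Unique xs → Unique ys
Unique-resp-↭ {A} p = PermSetoid.Unique-resp-↭ (≡.setoid A) (↭⇒↭ₛ p)

Unique-labelSet : ∀ s → Unique (labelSet s)
Unique-labelSet s = Unique.map⁺ suc-injective (Unique.upTo⁺ s)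

length-labelSet : ∀ s → length (labelSet s) ≡ s
length-labelSet s = ≡-trans (length-map suc (upTo s)) (length-upTo s)

++-swapʳ : {A : Set} (xs ys zs : List A) → (xs ++ ys) ++ zs ↭ (xs ++ zs) ++ ys
++-swapʳ xs ys zs =
  ↭-trans (++-assoc xs ys zs) (↭-trans (++⁺ˡ xs (++-comm ys zs)) (↭-sym (++-assoc xs zs ys)))

Pointwise-↭⇒↭-Pointwise : {A : Set} {R : A → A → Set} {us ts vs : List A} →
  Pointwise R us ts → ts ↭ vs → Σ (List A) λ ws → us ↭ ws × Pointwise R ws vs
Pointwise-↭⇒↭-Pointwise rs refl = _ , refl , rs
Pointwise-↭⇒↭-Pointwise (r ∷ rs) (prep x p) with Pointwise-↭⇒↭-Pointwise rs p
... | _ , q , rs′ = _ , prep _ q , r ∷ rs′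
Pointwise-↭⇒↭-Pointwise (r₁ ∷ r₂ ∷ rs) (swap x y p) with Pointwise-↭⇒↭-Pointwise rs p
... | _ , q , rs′ = _ , swap _ _ q , r₂ ∷ r₁ ∷ rs′
Pointwise-↭⇒↭-Pointwise rs (trans p₁ p₂) with Pointwise-↭⇒↭-Pointwise rs p₁
... | _ , q₁ , rs₁ with Pointwise-↭⇒↭-Pointwise rs₁ p₂
... | _ , q₂ , rs₂ = _ , trans q₁ q₂ , rs₂

classCount-fromCanonical :
  {A C : Set} {P : A → Set} {_≈_ : A → A → Set}
  (canon : List C) (embed : C → A) → Unique canon →
  (∀ {c} → c ∈ canon → P (embed c)) →
  (∀ {c d} → c ∈ canon → d ∈ canon → embed c ≈ embed d → c ≡ d) →
  (∀ a → P a → Σ C λ c → c ∈ canon × a ≈ embed c) →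
  ClassCount P _≈_ (length canon)
classCount-fromCanonical {P = P} {_≈_ = _≈_} canon embed unique valid reflect classify = record
  { rep      = λ i → embed (lookup canon i)
  ; rep-ok   = λ i → valid (∈-lookup i)
  ; rep-inj  = λ i j e → lookup-injective unique i j (reflect (∈-lookup i) (∈-lookup j) e)
  ; rep-surj = surj
  }
  where
  surj : ∀ a → P a → Σ (Fin (length canon)) λ i → a ≈ embed (lookup canon i)
  surj a pa with classify a pa
  ... | c , c∈ , a≈c = index c∈ , subst (λ d → a ≈ embed d) (lookup-index c∈) a≈c

-- Series-reduced trees

module _ {m : ℕ} where

  mutual
    ≅S-refl : (t : STree m) → t ≅S t
    ≅S-refl (leaf l)    = leaf
    ≅S-refl (node c ts) = node (ts , refl , Pointwise-≅S-refl ts)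

    Pointwise-≅S-refl : (ts : List (STree m)) → Pointwise _≅S_ ts ts
    Pointwise-≅S-refl []       = []
    Pointwise-≅S-refl (t ∷ ts) = ≅S-refl t ∷ Pointwise-≅S-refl ts

  mutual
    ≅S-trans : {t u v : STree m} → t ≅S u → u ≅S v → t ≅S v
    ≅S-trans leaf leaf = leaf
    ≅S-trans (node (_ , p , rs)) (node (_ , q , rs′)) with Pointwise-↭⇒↭-Pointwise rs q
    ... | _ , q′ , rs″ = node (_ , trans p q′ , Pointwise-≅S-trans rs″ rs′)

    Pointwise-≅S-trans : {ts us vs : List (STree m)} →
      Pointwise _≅S_ ts us → Pointwise _≅S_ us vs → Pointwise _≅S_ ts vs
    Pointwise-≅S-trans []       []         = []
    Pointwise-≅S-trans (r ∷ rs) (r′ ∷ rs′) = ≅S-trans r r′ ∷ Pointwise-≅S-trans rs rs′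

  -- Isomorphism of forests; node c ts ≅S node c us unfolds to ts ≅F us.
  infix 4 _≅F_
  _≅F_ : List (STree m) → List (STree m) → Set
  ts ≅F us = Σ (List (STree m)) λ vs → ts ↭ vs × Pointwise _≅S_ vs us

  ≅F-refl : (ts : List (STree m)) → ts ≅F ts
  ≅F-refl ts = ts , refl , Pointwise-≅S-refl ts

  ↭⇒≅F : {ts us : List (STree m)} → ts ↭ us → ts ≅F us
  ↭⇒≅F {us = us} p = us , p , Pointwise-≅S-refl us

  ≅F-trans : {ts us vs : List (STree m)} → ts ≅F us → us ≅F vs → ts ≅F vs
  ≅F-trans (_ , p , rs) (_ , q , rs′) with Pointwise-↭⇒↭-Pointwise rs q
  ... | _ , q′ , rs″ = _ , trans p q′ , Pointwise-≅S-trans rs″ rs′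

  ≅F-refl′ : {ts us : List (STree m)} → ts ≡ us → ts ≅F us
  ≅F-refl′ refl = ≅F-refl _

  ≅F-∷ : {t u : STree m} {ts us : List (STree m)} → t ≅S u → ts ≅F us → t ∷ ts ≅F u ∷ us
  ≅F-∷ r (_ , p , rs) = _ , prep _ p , r ∷ rs

  ≅F-length : {ts us : List (STree m)} → ts ≅F us → length ts ≡ length us
  ≅F-length (_ , p , rs) = ≡-trans (↭-length p) (Pointwise-length rs)

  mutual
    recolour : (Fin m → Fin m) → STree m → STree m
    recolour π (leaf l)    = leaf l
    recolour π (node c ts) = node (π c) (recolourF π ts)

    recolourF : (Fin m → Fin m) → List (STree m) → List (STree m)
    recolourF π []       = []
    recolourF π (t ∷ ts) = recolour π t ∷ recolourF π ts

  mutual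
    recolour-cong : {π ρ : Fin m → Fin m} → π ≗ ρ → ∀ t → recolour π t ≡ recolour ρ t
    recolour-cong π≗ρ (leaf l)    = refl
    recolour-cong π≗ρ (node c ts) = cong₂ node (π≗ρ c) (recolourF-cong π≗ρ ts)

    recolourF-cong : {π ρ : Fin m → Fin m} → π ≗ ρ → ∀ ts → recolourF π ts ≡ recolourF ρ ts
    recolourF-cong π≗ρ []       = refl
    recolourF-cong π≗ρ (t ∷ ts) = cong₂ _∷_ (recolour-cong π≗ρ t) (recolourF-cong π≗ρ ts)

  mutual
    recolour-∘ : ∀ π ρ t → recolour π (recolour ρ t) ≡ recolour (π ∘ ρ) t
    recolour-∘ π ρ (leaf l)    = refl
    recolour-∘ π ρ (node c ts) = cong (node (π (ρ c))) (recolourF-∘ π ρ ts)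

    recolourF-∘ : ∀ π ρ ts → recolourF π (recolourF ρ ts) ≡ recolourF (π ∘ ρ) ts
    recolourF-∘ π ρ []       = refl
    recolourF-∘ π ρ (t ∷ ts) = cong₂ _∷_ (recolour-∘ π ρ t) (recolourF-∘ π ρ ts)

  mutual
    recolour-id : ∀ t → recolour id t ≡ t
    recolour-id (leaf l)    = refl
    recolour-id (node c ts) = cong (node c) (recolourF-id ts)

    recolourF-id : ∀ ts → recolourF id ts ≡ ts
    recolourF-id []       = refl
    recolourF-id (t ∷ ts) = cong₂ _∷_ (recolour-id t) (recolourF-id ts)

  mutual
    slabels-recolour : ∀ π t → slabels (recolour π t) ≡ slabels t
    slabels-recolour π (leaf l)    = refl
    slabels-recolour π (node c ts) = slabelsL-recolourF π ts

    slabelsL-recolourF : ∀ π ts → slabelsL (recolourF π ts) ≡ slabelsL ts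
    slabelsL-recolourF π []       = refl
    slabelsL-recolourF π (t ∷ ts) = cong₂ _++_ (slabels-recolour π t) (slabelsL-recolourF π ts)

  recolourF-↭ : ∀ π {ts us} → ts ↭ us → recolourF π ts ↭ recolourF π us
  recolourF-↭ π refl         = refl
  recolourF-↭ π (prep t p)   = prep _ (recolourF-↭ π p)
  recolourF-↭ π (swap t u p) = swap _ _ (recolourF-↭ π p)
  recolourF-↭ π (trans p q)  = trans (recolourF-↭ π p) (recolourF-↭ π q)

  mutual
    recolour-≅S : ∀ π {t u} → t ≅S u → recolour π t ≅S recolour π u
    recolour-≅S π leaf                = leaf
    recolour-≅S π (node ts≅us) = node (recolourF-≅F π ts≅us)

    recolourF-≅F : ∀ π {ts us} → ts ≅F us → recolourF π ts ≅F recolourF π us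
    recolourF-≅F π (vs , p , rs) = recolourF π vs , recolourF-↭ π p , recolourF-Pointwise π rs

    recolourF-Pointwise : ∀ π {ts us} → Pointwise _≅S_ ts us →
                          Pointwise _≅S_ (recolourF π ts) (recolourF π us)
    recolourF-Pointwise π []       = []
    recolourF-Pointwise π (r ∷ rs) = recolour-≅S π r ∷ recolourF-Pointwise π rs

  length-recolourF : ∀ π ts → length (recolourF π ts) ≡ length ts
  length-recolourF π []       = refl
  length-recolourF π (t ∷ ts) = cong suc (length-recolourF π ts)

  module _ {π : Fin m → Fin m} (π-inj : Injective _≡_ _≡_ π) where

    ColorDiff-recolour : ∀ {c t} → ColorDiff c t → ColorDiff (π c) (recolour π t)
    ColorDiff-recolour leaf      = leaf
    ColorDiff-recolour (node c≢) = node (c≢ ∘ π-inj)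

    All-ColorDiff-recolourF : ∀ {c ts} → All (ColorDiff c) ts → All (ColorDiff (π c)) (recolourF π ts)
    All-ColorDiff-recolourF []       = []
    All-ColorDiff-recolourF (d ∷ ds) = ColorDiff-recolour d ∷ All-ColorDiff-recolourF ds

    mutual
      SWellFormed-recolour : ∀ {t} → SWellFormed t → SWellFormed (recolour π t)
      SWellFormed-recolour leaf = leaf
      SWellFormed-recolour (node {ts = ts} 2≤ ds ws) =
        node (subst (2 ≤_) (sym (length-recolourF π ts)) 2≤) (All-ColorDiff-recolourF ds)
             (All-SWellFormed-recolourF ws)

      All-SWellFormed-recolourF : ∀ {ts} → All SWellFormed ts → All SWellFormed (recolourF π ts)
      All-SWellFormed-recolourF []       = []
      All-SWellFormed-recolourF (w ∷ ws) = SWellFormed-recolour w ∷ All-SWellFormed-recolourF ws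

  -- minF [] = 0 is a junk value: well-formed inner vertices have children.
  mutual
    minS : STree m → ℕ
    minS (leaf l)    = l
    minS (node c ts) = minF ts

    minF : List (STree m) → ℕ
    minF []           = 0
    minF (t ∷ [])     = minS t
    minF (t ∷ u ∷ ts) = minS t ⊓ minF (u ∷ ts)

  mutual
    minS-recolour : ∀ π t → minS (recolour π t) ≡ minS t
    minS-recolour π (leaf l)    = refl
    minS-recolour π (node c ts) = minF-recolourF π ts

    minF-recolourF : ∀ π ts → minF (recolourF π ts) ≡ minF ts
    minF-recolourF π []           = refl
    minF-recolourF π (t ∷ [])     = minS-recolour π t
    minF-recolourF π (t ∷ u ∷ ts) = cong₂ _⊓_ (minS-recolour π t) (minF-recolourF π (u ∷ ts))

  mutual
    minS≤slabels : ∀ t → All (minS t ≤_) (slabels t)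
    minS≤slabels (leaf l)    = ≤-refl ∷ []
    minS≤slabels (node c ts) = minF≤slabelsL ts

    minF≤slabelsL : ∀ ts → All (minF ts ≤_) (slabelsL ts)
    minF≤slabelsL []           = []
    minF≤slabelsL (t ∷ [])     = AllProps.++⁺ (minS≤slabels t) []
    minF≤slabelsL (t ∷ u ∷ ts) =
      AllProps.++⁺ (All.map (≤-trans (m⊓n≤m (minS t) (minF (u ∷ ts)))) (minS≤slabels t))
              (All.map (≤-trans (m⊓n≤n (minS t) (minF (u ∷ ts)))) (minF≤slabelsL (u ∷ ts)))

  mutual
    minS∈slabels : ∀ {t} → SWellFormed t → minS t ∈ slabels t
    minS∈slabels leaf                              = here refl
    minS∈slabels (node {ts = t ∷ ts} _ _ ws) = minF∈slabelsL ws

    minF∈slabelsL : ∀ {t ts} → All SWellFormed (t ∷ ts) → minF (t ∷ ts) ∈ slabelsL (t ∷ ts)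
    minF∈slabelsL {t} {[]}     (w ∷ []) = ∈-++⁺ˡ (minS∈slabels w)
    minF∈slabelsL {t} {u ∷ ts} (w ∷ ws) with ⊓-sel (minS t) (minF (u ∷ ts))
    ... | inj₁ e rewrite e = ∈-++⁺ˡ (minS∈slabels w)
    ... | inj₂ e rewrite e = ∈-++⁺ʳ (slabels t) (minF∈slabelsL ws)

  ∈-slabelsL : ∀ {l} {t : STree m} {ts} → t ∈ ts → l ∈ slabels t → l ∈ slabelsL ts
  ∈-slabelsL (here refl)              l∈ = ∈-++⁺ˡ l∈
  ∈-slabelsL {ts = u ∷ _} (there t∈) l∈ = ∈-++⁺ʳ (slabels u) (∈-slabelsL t∈ l∈)

  DistinctMins : List (STree m) → Set
  DistinctMins = AllPairs (λ t u → minS t ≢ minS u)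

  DistinctMins-resp-↭ : ∀ {ts us} → ts ↭ us → DistinctMins ts → DistinctMins us
  DistinctMins-resp-↭ p =
    PermSetoid.AllPairs-resp-↭ (≡.setoid (STree m)) (_∘ sym) (≡.resp₂ _) (↭⇒↭ₛ p)

  -- Isomorphism invariance of the inverse map rests on this: it reads children
  -- in increasing order of their minimal labels.
  data DistinctChildMins : STree m → Set where
    leaf : ∀ {l} → DistinctChildMins (leaf l)
    node : ∀ {c ts} → DistinctMins ts → All DistinctChildMins ts → DistinctChildMins (node c ts)

  DistinctMins-fromLabels : ∀ {ts} → All SWellFormed ts → Unique (slabelsL ts) → DistinctMins ts
  DistinctMins-fromLabels []               u = []
  DistinctMins-fromLabels {t ∷ ts} (w ∷ ws) u with Unique-++⁻ (slabels t) u
  ... | _ , u′ , disjoint = All.tabulate minS≢ ∷ DistinctMins-fromLabels ws u′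
    where
    minS≢ : ∀ {v} → v ∈ ts → minS t ≢ minS v
    minS≢ {v} v∈ts e = disjoint (minS∈slabels w)
      (∈-slabelsL v∈ts (subst (_∈ slabels v) (sym e) (minS∈slabels (lookupAll ws v∈ts))))

  mutual
    DistinctChildMins-fromLabels : ∀ {t} → SWellFormed t → Unique (slabels t) → DistinctChildMins t
    DistinctChildMins-fromLabels leaf          u = leaf
    DistinctChildMins-fromLabels (node _ _ ws) u =
      node (DistinctMins-fromLabels ws u) (All-DistinctChildMins-fromLabels ws u)

    All-DistinctChildMins-fromLabels : ∀ {ts} → All SWellFormed ts → Unique (slabelsL ts) →
                                       All DistinctChildMins ts
    All-DistinctChildMins-fromLabels []               u = []
    All-DistinctChildMins-fromLabels {t ∷ ts} (w ∷ ws) u with Unique-++⁻ (slabels t) u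
    ... | ut , uts , _ = DistinctChildMins-fromLabels w ut ∷ All-DistinctChildMins-fromLabels ws uts

  DistinctChildMins-valid : ∀ {s t} → IsSTree m s t → DistinctChildMins t
  DistinctChildMins-valid {s} (p , w) =
    DistinctChildMins-fromLabels w (Unique-resp-↭ (↭-sym p) (Unique-labelSet s))

-- Chain-increasing trees and their canonical forms

module _ {k : ℕ} where

  chain : ℕ → Maybe (YTree k) → YTree k
  chain l nothing  = chain0 l
  chain l (just t) = chain1 l t

  -- Descending from the root through first subtrees one reaches a chain vertex, the spine
  -- end; minY is its label and restOf its child.
  minY : YTree k → ℕ
  minY (chain0 l)       = l
  minY (chain1 l _)     = l
  minY (junction _ a _) = minY a

  restOf : YTree k → Maybe (YTree k)
  restOf (chain0 l)       = nothing
  restOf (chain1 l t)     = just t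
  restOf (junction _ a _) = restOf a

  replaceRest : YTree k → Maybe (YTree k) → YTree k
  replaceRest (chain0 l)       r = chain l r
  replaceRest (chain1 l _)     r = chain l r
  replaceRest (junction c a b) r = junction c (replaceRest a r) b

  ylabelsM : Maybe (YTree k) → List ℕ
  ylabelsM nothing  = []
  ylabelsM (just t) = ylabels t

  minY-chain : ∀ l r → minY (chain l r) ≡ l
  minY-chain l nothing  = refl
  minY-chain l (just _) = refl

  restOf-chain : ∀ l r → restOf (chain l r) ≡ r
  restOf-chain l nothing  = refl
  restOf-chain l (just _) = refl

  replaceRest-chain : ∀ l r r′ → replaceRest (chain l r) r′ ≡ chain l r′
  replaceRest-chain l nothing  r′ = refl
  replaceRest-chain l (just _) r′ = refl

  minY-replaceRest : ∀ t r → minY (replaceRest t r) ≡ minY t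
  minY-replaceRest (chain0 l)       r = minY-chain l r
  minY-replaceRest (chain1 l _)     r = minY-chain l r
  minY-replaceRest (junction c a b) r = minY-replaceRest a r

  restOf-replaceRest : ∀ t r → restOf (replaceRest t r) ≡ r
  restOf-replaceRest (chain0 l)       r = restOf-chain l r
  restOf-replaceRest (chain1 l _)     r = restOf-chain l r
  restOf-replaceRest (junction c a b) r = restOf-replaceRest a r

  replaceRest² : ∀ t r r′ → replaceRest (replaceRest t r) r′ ≡ replaceRest t r′
  replaceRest² (chain0 l)       r r′ = replaceRest-chain l r r′
  replaceRest² (chain1 l _)     r r′ = replaceRest-chain l r r′
  replaceRest² (junction c a b) r r′ = cong (λ a′ → junction c a′ b) (replaceRest² a r r′)

  replaceRest-restOf : ∀ t → replaceRest t (restOf t) ≡ t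
  replaceRest-restOf (chain0 l)       = refl
  replaceRest-restOf (chain1 l _)     = refl
  replaceRest-restOf (junction c a b) = cong (λ a′ → junction c a′ b) (replaceRest-restOf a)

  minY∈ylabels : ∀ t → minY t ∈ ylabels t
  minY∈ylabels (chain0 l)       = here refl
  minY∈ylabels (chain1 l t)     = here refl
  minY∈ylabels (junction c a b) = ∈-++⁺ˡ (minY∈ylabels a)

  ylabels-replaceRest : ∀ t r →
                        ylabels (replaceRest t r) ↭ ylabels (replaceRest t nothing) ++ ylabelsM r
  ylabels-replaceRest (chain0 l)       nothing  = refl
  ylabels-replaceRest (chain0 l)       (just _) = refl
  ylabels-replaceRest (chain1 l _)     nothing  = refl
  ylabels-replaceRest (chain1 l _)     (just _) = refl
  ylabels-replaceRest (junction c a b) r =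
    ↭-trans (++⁺ʳ (ylabels b) (ylabels-replaceRest a r))
            (++-swapʳ (ylabels (replaceRest a nothing)) (ylabelsM r) (ylabels b))

  ylabels-restOf : ∀ t → ylabels t ↭ ylabels (replaceRest t nothing) ++ ylabelsM (restOf t)
  ylabels-restOf t =
    subst (λ t′ → ylabels t′ ↭ ylabels (replaceRest t nothing) ++ ylabelsM (restOf t))
          (replaceRest-restOf t) (ylabels-replaceRest t (restOf t))

  Canonical : YTree k → Set
  Canonical (chain0 l)       = ⊤
  Canonical (chain1 l t)     = All (l <_) (ylabels t) × Canonical t
  Canonical (junction c a b) = minY a < minY b × Canonical a × Canonical b

  CanonicalM : Maybe (YTree k) → Set
  CanonicalM nothing  = ⊤
  CanonicalM (just t) = Canonical t

  Canonical⇒YIncreasing : ∀ {t} → Canonical t → YIncreasing t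
  Canonical⇒YIncreasing {chain0 l}       _             = chain0
  Canonical⇒YIncreasing {chain1 l t}     (l< , ct)     = chain1 l< (Canonical⇒YIncreasing ct)
  Canonical⇒YIncreasing {junction c a b} (_ , ca , cb) =
    junction (Canonical⇒YIncreasing ca) (Canonical⇒YIncreasing cb)

  minY≤ylabels : ∀ {t} → Canonical t → All (minY t ≤_) (ylabels t)
  minY≤ylabels {chain0 l}       _               = ≤-refl ∷ []
  minY≤ylabels {chain1 l t}     (l< , _)        = ≤-refl ∷ All.map <⇒≤ l<
  minY≤ylabels {junction c a b} (a<b , ca , cb) =
    AllProps.++⁺ (minY≤ylabels ca) (All.map (≤-trans (<⇒≤ a<b)) (minY≤ylabels cb))

  minY<ylabelsM-restOf : ∀ {t} → Canonical t → All (minY t <_) (ylabelsM (restOf t))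
  minY<ylabelsM-restOf {chain0 l}       _            = []
  minY<ylabelsM-restOf {chain1 l t}     (l< , _)     = l<
  minY<ylabelsM-restOf {junction c a b} (_ , ca , _) = minY<ylabelsM-restOf ca

  CanonicalM-restOf : ∀ {t} → Canonical t → CanonicalM (restOf t)
  CanonicalM-restOf {chain0 l}       _            = tt
  CanonicalM-restOf {chain1 l t}     (_ , ct)     = ct
  CanonicalM-restOf {junction c a b} (_ , ca , _) = CanonicalM-restOf ca

  Canonical-replaceRest : ∀ {t} → Canonical t → ∀ r → CanonicalM r →
                          All (minY t <_) (ylabelsM r) → Canonical (replaceRest t r)
  Canonical-replaceRest {chain0 l}       _ nothing  _  _  = tt
  Canonical-replaceRest {chain0 l}       _ (just _) cr t< = t< , cr
  Canonical-replaceRest {chain1 l _}     _ nothing  _  _  = tt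
  Canonical-replaceRest {chain1 l _}     _ (just _) cr t< = t< , cr
  Canonical-replaceRest {junction c a b} (a<b , ca , cb) r cr t< =
    subst (_< minY b) (sym (minY-replaceRest a r)) a<b , Canonical-replaceRest ca r cr t< , cb

  ≅Y⇒↭ : {t u : YTree k} → t ≅Y u → ylabels t ↭ ylabels u
  ≅Y⇒↭ chain0                          = refl
  ≅Y⇒↭ (chain1 t≅u)                    = prep _ (≅Y⇒↭ t≅u)
  ≅Y⇒↭ (junction (inj₁ (a≅a′ , b≅b′))) = ++⁺ (≅Y⇒↭ a≅a′) (≅Y⇒↭ b≅b′)
  ≅Y⇒↭ (junction {a' = a′} {b' = b′} (inj₂ (a≅b′ , b≅a′))) =
    ↭-trans (++⁺ (≅Y⇒↭ a≅b′) (≅Y⇒↭ b≅a′)) (++-comm (ylabels b′) (ylabels a′))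

  minY-resp-↭ : ∀ {t u} → Canonical t → Canonical u → ylabels t ↭ ylabels u → minY t ≡ minY u
  minY-resp-↭ {t} {u} ct cu p =
    ≤-antisym (lookupAll (minY≤ylabels ct) (∈-resp-↭ (↭-sym p) (minY∈ylabels u)))
              (lookupAll (minY≤ylabels cu) (∈-resp-↭ p (minY∈ylabels t)))

  Canonical-≅Y⇒≡ : ∀ {t u} → Canonical t → Canonical u → t ≅Y u → t ≡ u
  Canonical-≅Y⇒≡ _ _ chain0 = refl
  Canonical-≅Y⇒≡ (_ , ct) (_ , cu) (chain1 t≅u) = cong (chain1 _) (Canonical-≅Y⇒≡ ct cu t≅u)
  Canonical-≅Y⇒≡ (_ , ca , cb) (_ , ca′ , cb′) (junction (inj₁ (a≅a′ , b≅b′))) =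
    cong₂ (junction _) (Canonical-≅Y⇒≡ ca ca′ a≅a′) (Canonical-≅Y⇒≡ cb cb′ b≅b′)
  Canonical-≅Y⇒≡ {junction c a b} {junction _ a′ b′} (a<b , ca , cb) (a′<b′ , ca′ , cb′)
                 (junction (inj₂ (a≅b′ , b≅a′))) =
    contradiction (subst₂ _<_ (minY-resp-↭ ca cb′ (≅Y⇒↭ a≅b′)) (minY-resp-↭ cb ca′ (≅Y⇒↭ b≅a′))
                              a<b)
                  (<-asym a′<b′)

  orderedJunction : Fin k → YTree k → YTree k → YTree k
  orderedJunction c a b with minY a <? minY b
  ... | yes _ = junction c a b
  ... | no _  = junction c b a

  orderedJunction-≅Y : ∀ {c a b a′ b′} → a ≅Y a′ → b ≅Y b′ →
                       junction c a b ≅Y orderedJunction c a′ b′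
  orderedJunction-≅Y {a′ = a′} {b′} a≅a′ b≅b′ with minY a′ <? minY b′
  ... | yes _ = junction (inj₁ (a≅a′ , b≅b′))
  ... | no _  = junction (inj₂ (a≅a′ , b≅b′))

  Canonical-orderedJunction : ∀ {c a b} → Canonical a → Canonical b → minY a ≢ minY b →
                              Canonical (orderedJunction c a b)
  Canonical-orderedJunction {a = a} {b} ca cb a≢b with minY a <? minY b
  ... | yes a<b = a<b , ca , cb
  ... | no a≮b  = ≤∧≢⇒< (≮⇒≥ a≮b) (a≢b ∘ sym) , cb , ca

  canonical : YTree k → YTree k
  canonical (chain0 l)       = chain0 l
  canonical (chain1 l t)     = chain1 l (canonical t)
  canonical (junction c a b) = orderedJunction c (canonical a) (canonical b)

  canonical-≅Y : ∀ t → t ≅Y canonical t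
  canonical-≅Y (chain0 l)       = chain0
  canonical-≅Y (chain1 l t)     = chain1 (canonical-≅Y t)
  canonical-≅Y (junction c a b) = orderedJunction-≅Y (canonical-≅Y a) (canonical-≅Y b)

  ylabels-canonical : ∀ t → ylabels (canonical t) ↭ ylabels t
  ylabels-canonical t = ↭-sym (≅Y⇒↭ (canonical-≅Y t))

  Canonical-canonical : ∀ {t} → YIncreasing t → Unique (ylabels t) → Canonical (canonical t)
  Canonical-canonical chain0 u = tt
  Canonical-canonical {chain1 l t} (chain1 l< inc) (_ ∷ u) =
    All-resp-↭ (↭-sym (ylabels-canonical t)) l< , Canonical-canonical inc u
  Canonical-canonical {junction c a b} (junction inc-a inc-b) u with Unique-++⁻ (ylabels a) u
  ... | ua , ub , disjoint =
    Canonical-orderedJunction (Canonical-canonical inc-a ua) (Canonical-canonical inc-b ub) minY≢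
    where
    minY≢ : minY (canonical a) ≢ minY (canonical b)
    minY≢ e = disjoint
      (∈-resp-↭ (ylabels-canonical a) (minY∈ylabels (canonical a)))
      (∈-resp-↭ (ylabels-canonical b)
                (subst (_∈ ylabels (canonical b)) (sym e) (minY∈ylabels (canonical b))))

  _≟Y_ : DecidableEquality (YTree k)
  chain0 l ≟Y chain0 l′ = map′ (cong chain0) (λ { refl → refl }) (l ≟ l′)
  chain1 l t ≟Y chain1 l′ t′ =
    map′ (λ { (refl , refl) → refl }) (λ { refl → refl , refl }) ((l ≟ l′) ×-dec (t ≟Y t′))
  junction c a b ≟Y junction c′ a′ b′ =
    map′ (λ { (refl , refl , refl) → refl }) (λ { refl → refl , refl , refl })
         ((c ≟F c′) ×-dec (a ≟Y a′) ×-dec (b ≟Y b′))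
  chain0 _       ≟Y chain1 _ _     = no λ ()
  chain0 _       ≟Y junction _ _ _ = no λ ()
  chain1 _ _     ≟Y chain0 _       = no λ ()
  chain1 _ _     ≟Y junction _ _ _ = no λ ()
  junction _ _ _ ≟Y chain0 _       = no λ ()
  junction _ _ _ ≟Y chain1 _ _     = no λ ()

  Canonical? : ∀ t → Dec (Canonical t)
  Canonical? (chain0 l)       = yes tt
  Canonical? (chain1 l t)     = all? (l <?_) (ylabels t) ×-dec Canonical? t
  Canonical? (junction c a b) = (minY a <? minY b) ×-dec Canonical? a ×-dec Canonical? b

  junctionsOver : List (YTree k) → Fin k → List (YTree k)
  junctionsOver ts c = cartesianProductWith (junction c) ts ts

  treesUpTo : ℕ → List ℕ → List (YTree k)
  treesUpTo zero    ls = []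
  treesUpTo (suc n) ls =
    map chain0 ls ++ cartesianProductWith chain1 ls (treesUpTo n ls) ++
    concatMap (junctionsOver (treesUpTo n ls)) (allFin k)

  0<length-ylabels : (t : YTree k) → 0 < length (ylabels t)
  0<length-ylabels (chain0 _)       = z<s
  0<length-ylabels (chain1 _ _)     = z<s
  0<length-ylabels (junction _ a b) = <-≤-trans (0<length-ylabels a) (length-++-≤ˡ (ylabels a))

  treesUpTo-complete : ∀ n ls (t : YTree k) → length (ylabels t) ≤ n → All (_∈ ls) (ylabels t) →
                       t ∈ treesUpTo n ls
  treesUpTo-complete zero ls t size≤ _ = contradiction size≤ (<⇒≱ (0<length-ylabels t))
  treesUpTo-complete (suc n) ls (chain0 l) _ (l∈ ∷ []) = ∈-++⁺ˡ (∈-map⁺ chain0 l∈)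
  treesUpTo-complete (suc n) ls (chain1 l t) (s≤s size≤) (l∈ ∷ t⊆) =
    ∈-++⁺ʳ (map chain0 ls)
      (∈-++⁺ˡ (∈-cartesianProductWith⁺ chain1 l∈ (treesUpTo-complete n ls t size≤ t⊆)))
  treesUpTo-complete (suc n) ls (junction c a b) size≤ ab⊆ with AllProps.++⁻ (ylabels a) ab⊆
  ... | a⊆ , b⊆ =
    ∈-++⁺ʳ (map chain0 ls) (∈-++⁺ʳ (cartesianProductWith chain1 ls (treesUpTo n ls))
      (∈-concatMap⁺ (junctionsOver (treesUpTo n ls)) (lose (∈-allFin c)
        (∈-cartesianProductWith⁺ (junction c) (treesUpTo-complete n ls a a≤n a⊆)
                                              (treesUpTo-complete n ls b b≤n b⊆)))))
    where
    size≤′ : length (ylabels a) + length (ylabels b) ≤ suc n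
    size≤′ = subst (_≤ suc n) (length-++ (ylabels a)) size≤
    a≤n : length (ylabels a) ≤ n
    a≤n = s≤s⁻¹ (<-≤-trans (m<m+n _ (0<length-ylabels b)) size≤′)
    b≤n : length (ylabels b) ≤ n
    b≤n = s≤s⁻¹ (<-≤-trans (m<n+m _ (0<length-ylabels a)) size≤′)

  module _ (s : ℕ) where

    CanonicalLabelled : YTree k → Set
    CanonicalLabelled t = Canonical t × ylabels t ↭ labelSet s

    CanonicalLabelled? : ∀ t → Dec (CanonicalLabelled t)
    CanonicalLabelled? t = Canonical? t ×-dec (ylabels t ↭? labelSet s)

    canonicalTrees : List (YTree k)
    canonicalTrees = deduplicate _≟Y_ (filter CanonicalLabelled? (treesUpTo s (labelSet s)))

    canonicalTrees-unique : Unique canonicalTrees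
    canonicalTrees-unique = UniqueDec.deduplicate-! _≟Y_ _

    ∈-canonicalTrees⁻ : ∀ {t} → t ∈ canonicalTrees → CanonicalLabelled t
    ∈-canonicalTrees⁻ t∈ =
      proj₂ (∈-filter⁻ CanonicalLabelled? {xs = treesUpTo s (labelSet s)}
                       (∈-deduplicate⁻ _≟Y_ _ t∈))

    ∈-canonicalTrees⁺ : ∀ {t} → CanonicalLabelled t → t ∈ canonicalTrees
    ∈-canonicalTrees⁺ {t} ct@(_ , p) = ∈-deduplicate⁺ _≟Y_ (∈-filter⁺ CanonicalLabelled?
      (treesUpTo-complete s (labelSet s) t
        (≡.subst (length (ylabels t) ≤_) (length-labelSet s) (≤-reflexive (↭-length p)))
        (All-resp-↭ (↭-sym p) (All.tabulate id)))
      ct)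

    canonicalise : ∀ t → IsYTree k s t → Σ (YTree k) λ c → c ∈ canonicalTrees × t ≅Y c
    canonicalise t (p , inc) = canonical t , ∈-canonicalTrees⁺ canonical-CL , canonical-≅Y t
      where
      canonical-CL : CanonicalLabelled (canonical t)
      canonical-CL = Canonical-canonical inc (Unique-resp-↭ (↭-sym p) (Unique-labelSet s))
                   , ↭-trans (ylabels-canonical t) p

    Y-count-canonicalTrees : Y-count k s (length canonicalTrees)
    Y-count-canonicalTrees = classCount-fromCanonical canonicalTrees id canonicalTrees-unique
      (λ c∈ → let (c , p) = ∈-canonicalTrees⁻ c∈ in p , Canonical⇒YIncreasing c)
      (λ c∈ d∈ → Canonical-≅Y⇒≡ (proj₁ (∈-canonicalTrees⁻ c∈))
                                 (proj₁ (∈-canonicalTrees⁻ d∈)))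
      canonicalise

-- The bijection

module Bijection (k : ℕ) where

  S : Set
  S = STree (suc k)

  Y : Set
  Y = YTree k

  Colouring : Set
  Colouring = Fin (suc k) → Fin (suc k)

  up down : Fin k → Colouring
  up c   = transpose zero (suc c)
  down c = transpose (suc c) zero

  down-up : ∀ c x → down c (up c x) ≡ x
  down-up c x = transpose-inverse (suc c) zero

  up-down : ∀ c x → up c (down c x) ≡ x
  up-down c x = transpose-inverse zero (suc c)

  up-injective : ∀ c → Injective _≡_ _≡_ (up c)
  up-injective c {x} {y} e = ≡-trans (sym (down-up c x)) (≡-trans (cong (down c) e) (down-up c y))

  down-injective : ∀ c → Injective _≡_ _≡_ (down c)
  down-injective c {x} {y} e = ≡-trans (sym (up-down c x)) (≡-trans (cong (up c) e) (up-down c y))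

  mutual
    headTree : Y → S
    headTree (chain0 l)       = leaf l
    headTree (chain1 l _)     = leaf l
    headTree (junction c a b) = node (suc c) (recolour (up c) (headTree a) ∷ recolourF (up c) (forest b))

    tailForest : Y → List S
    tailForest (chain0 l)       = []
    tailForest (chain1 l t)     = forest t
    tailForest (junction c a b) = tailForest a

    forest : Y → List S
    forest t = headTree t ∷ tailForest t

  forestM : Maybe Y → List S
  forestM nothing  = []
  forestM (just t) = forest t

  -- plant [] is junk: forests are never empty.
  plant : List S → S
  plant []           = leaf 0
  plant (t ∷ [])     = t
  plant (t ∷ u ∷ ts) = node zero (t ∷ u ∷ ts)

  toS : Y → S
  toS t = plant (forest t)

  -- fromJunction c nothing and fromNode zero are junk cases: well-formed inner vertices
  -- have children, and every vertex met by fromNode has a non-zero σ-colour.  The value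
  -- chain (minF ts) r makes minY (fromTree σ t r) ≡ minS t hold unconditionally.
  fromJunction : Fin k → Maybe Y → Maybe Y → Y
  fromJunction c nothing  r = chain 0 r
  fromJunction c (just z) r = junction c (replaceRest z r) (fromMaybe z (restOf z))

  -- fromTree σ t r reads t, its colours translated by σ, as a tree whose spine end has
  -- child r.  Translating colours lazily rather than recolouring subtrees keeps the
  -- recursion structural.
  mutual
    fromTree : Colouring → S → Maybe Y → Y
    fromTree σ (leaf l)    r = chain l r
    fromTree σ (node c ts) r = fromNode (σ c) σ ts r

    fromNode : Fin (suc k) → Colouring → List S → Maybe Y → Y
    fromNode zero    σ ts r = chain (minF ts) r
    fromNode (suc c) σ ts r = fromJunction c (fromForest (down c ∘ σ) ts) r

    fromForest : Colouring → List S → Maybe Y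
    fromForest σ []       = nothing
    fromForest σ (t ∷ ts) = just (insertM σ t (fromForest σ ts))

    insertM : Colouring → S → Maybe Y → Y
    insertM σ t nothing  = fromTree σ t nothing
    insertM σ t (just r) = insert σ t r

    insert : Colouring → S → Y → Y
    insert σ t r = insertIf (minS t <? minY r) σ t r

    insertIf : {P : Set} → Dec P → Colouring → S → Y → Y
    insertIf (yes _) σ t r = fromTree σ t (just r)
    insertIf (no _)  σ t r = insertBelow σ t r

    insertBelow : Colouring → S → Y → Y
    insertBelow σ t (chain0 l)       = chain1 l (fromTree σ t nothing)
    insertBelow σ t (chain1 l u)     = chain1 l (insert σ t u)
    insertBelow σ t (junction c a b) = junction c (insertBelow σ t a) b

  uproot : S → List S
  uproot (leaf l)          = leaf l ∷ []
  uproot (node zero ts)    = ts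
  uproot (node (suc c) ts) = node (suc c) ts ∷ []

  toY : S → Y
  toY t = fromMaybe (chain0 0) (fromForest id (uproot t))

  insert-< : ∀ σ t r → minS t < minY r → insert σ t r ≡ fromTree σ t (just r)
  insert-< σ t r t<r with minS t <? minY r
  ... | yes _  = refl
  ... | no t≮r = contradiction t<r t≮r

  insert-≮ : ∀ σ t r → ¬ minS t < minY r → insert σ t r ≡ insertBelow σ t r
  insert-≮ σ t r t≮r with minS t <? minY r
  ... | yes t<r = contradiction t<r t≮r
  ... | no _    = refl

  fromNode-replaceRest : ∀ x σ ts r → fromNode x σ ts r ≡ replaceRest (fromNode x σ ts nothing) r
  fromNode-replaceRest zero    σ ts r = sym (replaceRest-chain _ nothing r)
  fromNode-replaceRest (suc c) σ ts r with fromForest (down c ∘ σ) ts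
  ... | nothing = refl
  ... | just z  = cong (λ a → junction c a (fromMaybe z (restOf z))) (sym (replaceRest² z nothing r))

  fromTree-replaceRest : ∀ σ t r → fromTree σ t r ≡ replaceRest (fromTree σ t nothing) r
  fromTree-replaceRest σ (leaf l)    r = sym (replaceRest-chain l nothing r)
  fromTree-replaceRest σ (node c ts) r = fromNode-replaceRest (σ c) σ ts r

  restOf-fromTree : ∀ σ t r → restOf (fromTree σ t r) ≡ r
  restOf-fromTree σ t r =
    ≡-trans (cong restOf (fromTree-replaceRest σ t r)) (restOf-replaceRest (fromTree σ t nothing) r)

  minY-insertBelow : ∀ σ t r → minY (insertBelow σ t r) ≡ minY r
  minY-insertBelow σ t (chain0 l)       = refl
  minY-insertBelow σ t (chain1 l u)     = refl
  minY-insertBelow σ t (junction c a b) = minY-insertBelow σ t a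

  mutual
    minY-fromTree : ∀ σ t r → minY (fromTree σ t r) ≡ minS t
    minY-fromTree σ (leaf l)    r = minY-chain l r
    minY-fromTree σ (node c ts) r = minY-fromNode (σ c) σ ts r

    minY-fromNode : ∀ x σ ts r → minY (fromNode x σ ts r) ≡ minF ts
    minY-fromNode zero    σ ts       r = minY-chain _ r
    minY-fromNode (suc c) σ []       r = minY-chain 0 r
    minY-fromNode (suc c) σ (t ∷ ts) r =
      ≡-trans (minY-replaceRest (insertM (down c ∘ σ) t (fromForest (down c ∘ σ) ts)) r)
              (minY-insertM-fromForest (down c ∘ σ) t ts)

    minY-insertM-fromForest : ∀ σ t ts → minY (insertM σ t (fromForest σ ts)) ≡ minF (t ∷ ts)
    minY-insertM-fromForest σ t []       = minY-fromTree σ t nothing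
    minY-insertM-fromForest σ t (u ∷ ts) =
      ≡-trans (minY-insert σ t (insertM σ u (fromForest σ ts)))
              (cong (minS t ⊓_) (minY-insertM-fromForest σ u ts))

    minY-insert : ∀ σ t r → minY (insert σ t r) ≡ minS t ⊓ minY r
    minY-insert σ t r with minS t <? minY r
    ... | yes t<r = ≡-trans (minY-fromTree σ t (just r)) (sym (m≤n⇒m⊓n≡m (<⇒≤ t<r)))
    ... | no t≮r  = ≡-trans (minY-insertBelow σ t r) (sym (m≥n⇒m⊓n≡n (≮⇒≥ t≮r)))

  minY-fromForest : ∀ σ ts → minY (fromMaybe (chain0 0) (fromForest σ ts)) ≡ minF ts
  minY-fromForest σ []       = refl
  minY-fromForest σ (t ∷ ts) = minY-insertM-fromForest σ t ts

  mutual
    fromTree-recolour : ∀ σ π ρ → σ ∘ π ≗ ρ → ∀ t r →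
                        fromTree σ (recolour π t) r ≡ fromTree ρ t r
    fromTree-recolour σ π ρ σπ≗ρ (leaf l)    r = refl
    fromTree-recolour σ π ρ σπ≗ρ (node c ts) r rewrite σπ≗ρ c =
      fromNode-recolourF (ρ c) σ π ρ σπ≗ρ ts r

    fromNode-recolourF : ∀ x σ π ρ → σ ∘ π ≗ ρ → ∀ ts r →
                         fromNode x σ (recolourF π ts) r ≡ fromNode x ρ ts r
    fromNode-recolourF zero    σ π ρ σπ≗ρ ts r = cong (λ l → chain l r) (minF-recolourF π ts)
    fromNode-recolourF (suc c) σ π ρ σπ≗ρ ts r = cong (λ z → fromJunction c z r)
      (fromForest-recolourF (down c ∘ σ) π (down c ∘ ρ) (cong (down c) ∘ σπ≗ρ) ts)

    fromForest-recolourF : ∀ σ π ρ → σ ∘ π ≗ ρ → ∀ ts →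
                           fromForest σ (recolourF π ts) ≡ fromForest ρ ts
    fromForest-recolourF σ π ρ σπ≗ρ []       = refl
    fromForest-recolourF σ π ρ σπ≗ρ (t ∷ ts) = cong just (≡-trans
      (cong (insertM σ (recolour π t)) (fromForest-recolourF σ π ρ σπ≗ρ ts))
      (insertM-recolour σ π ρ σπ≗ρ t (fromForest ρ ts)))

    insertM-recolour : ∀ σ π ρ → σ ∘ π ≗ ρ → ∀ t r →
                       insertM σ (recolour π t) r ≡ insertM ρ t r
    insertM-recolour σ π ρ σπ≗ρ t nothing  = fromTree-recolour σ π ρ σπ≗ρ t nothing
    insertM-recolour σ π ρ σπ≗ρ t (just r) = insert-recolour σ π ρ σπ≗ρ t r

    insert-recolour : ∀ σ π ρ → σ ∘ π ≗ ρ → ∀ t r →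
                      insert σ (recolour π t) r ≡ insert ρ t r
    insert-recolour σ π ρ σπ≗ρ t r with minS (recolour π t) <? minY r | minS t <? minY r
    ... | yes _   | yes _   = fromTree-recolour σ π ρ σπ≗ρ t (just r)
    ... | no _    | no _    = insertBelow-recolour σ π ρ σπ≗ρ t r
    ... | yes t<r | no t≮r  = contradiction (subst (_< minY r) (minS-recolour π t) t<r) t≮r
    ... | no t≮r  | yes t<r = contradiction (subst (_< minY r) (sym (minS-recolour π t)) t<r) t≮r

    insertBelow-recolour : ∀ σ π ρ → σ ∘ π ≗ ρ → ∀ t r →
                           insertBelow σ (recolour π t) r ≡ insertBelow ρ t r
    insertBelow-recolour σ π ρ σπ≗ρ t (chain0 l)       =
      cong (chain1 l) (fromTree-recolour σ π ρ σπ≗ρ t nothing)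
    insertBelow-recolour σ π ρ σπ≗ρ t (chain1 l u)     =
      cong (chain1 l) (insert-recolour σ π ρ σπ≗ρ t u)
    insertBelow-recolour σ π ρ σπ≗ρ t (junction c a b) =
      cong (λ a′ → junction c a′ b) (insertBelow-recolour σ π ρ σπ≗ρ t a)

  headTree-replaceRest : ∀ t r → headTree (replaceRest t r) ≡ headTree t
  headTree-replaceRest (chain0 l)       nothing  = refl
  headTree-replaceRest (chain0 l)       (just _) = refl
  headTree-replaceRest (chain1 l _)     nothing  = refl
  headTree-replaceRest (chain1 l _)     (just _) = refl
  headTree-replaceRest (junction c a b) r =
    cong (λ h → node (suc c) (recolour (up c) h ∷ recolourF (up c) (forest b))) (headTree-replaceRest a r)

  tailForest-replaceRest : ∀ t r → tailForest (replaceRest t r) ≡ forestM r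
  tailForest-replaceRest (chain0 l)       nothing  = refl
  tailForest-replaceRest (chain0 l)       (just _) = refl
  tailForest-replaceRest (chain1 l _)     nothing  = refl
  tailForest-replaceRest (chain1 l _)     (just _) = refl
  tailForest-replaceRest (junction c a b) r        = tailForest-replaceRest a r

  tailForest-restOf : ∀ t → tailForest t ≡ forestM (restOf t)
  tailForest-restOf (chain0 l)       = refl
  tailForest-restOf (chain1 l _)     = refl
  tailForest-restOf (junction c a b) = tailForest-restOf a

  mutual
    fromTree-headTree : ∀ {t} → Canonical t → ∀ r → fromTree id (headTree t) r ≡ replaceRest t r
    fromTree-headTree {chain0 l}       _               r = refl
    fromTree-headTree {chain1 l _}     _               r = refl
    fromTree-headTree {junction c a b} (a<b , ca , cb) r = begin
      fromJunction c (fromForest (down c) (recolourF (up c) (headTree a ∷ forest b))) r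
        ≡⟨ cong (λ z → fromJunction c z r)
                (fromForest-recolourF (down c) (up c) id (down-up c) (headTree a ∷ forest b)) ⟩
      fromJunction c (just (insertM id (headTree a) (fromForest id (forest b)))) r
        ≡⟨ cong (λ z → fromJunction c (just (insertM id (headTree a) z)) r) (fromForest-forest cb) ⟩
      fromJunction c (just (insertM id (headTree a) (just b))) r
        ≡⟨ cong (λ z → fromJunction c (just z) r)
                (insertM-headTree ca (just b) (All.map (<-≤-trans a<b) (minY≤ylabels cb))) ⟩
      junction c (replaceRest (replaceRest a (just b)) r) (fromMaybe _ (restOf (replaceRest a (just b))))
        ≡⟨ cong₂ (junction c) (replaceRest² a (just b) r)
                                (cong (fromMaybe _) (restOf-replaceRest a (just b))) ⟩
      junction c (replaceRest a r) b ∎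
      where open ≡.≡-Reasoning

    insertM-headTree : ∀ {t} → Canonical t → ∀ r → All (minY t <_) (ylabelsM r) →
                       insertM id (headTree t) r ≡ replaceRest t r
    insertM-headTree ct nothing  _  = fromTree-headTree ct nothing
    insertM-headTree {t} ct (just u) t< =
      ≡-trans (insert-< id (headTree t) u (subst (_< minY u) (sym minS-headTree) (lookupAll t< (minY∈ylabels u))))
              (fromTree-headTree ct (just u))
      where
      minS-headTree : minS (headTree t) ≡ minY t
      minS-headTree = begin
        minS (headTree t)                       ≡⟨ sym (minY-fromTree id (headTree t) nothing) ⟩
        minY (fromTree id (headTree t) nothing) ≡⟨ cong minY (fromTree-headTree ct nothing) ⟩
        minY (replaceRest t nothing)            ≡⟨ minY-replaceRest t nothing ⟩
        minY t                                  ∎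
        where open ≡.≡-Reasoning

    fromForest-tailForest : ∀ {t} → Canonical t → fromForest id (tailForest t) ≡ restOf t
    fromForest-tailForest {chain0 l}       _            = refl
    fromForest-tailForest {chain1 l u}     (_ , cu)     = fromForest-forest cu
    fromForest-tailForest {junction c a b} (_ , ca , _) = fromForest-tailForest ca

    fromForest-forest : ∀ {t} → Canonical t → fromForest id (forest t) ≡ just t
    fromForest-forest {t} ct = cong just (begin
      insertM id (headTree t) (fromForest id (tailForest t))
        ≡⟨ cong (insertM id (headTree t)) (fromForest-tailForest ct) ⟩
      insertM id (headTree t) (restOf t)
        ≡⟨ insertM-headTree ct (restOf t) (minY<ylabelsM-restOf ct) ⟩
      replaceRest t (restOf t)
        ≡⟨ replaceRest-restOf t ⟩
      t ∎)
      where open ≡.≡-Reasoning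

  uproot-toS : ∀ t → uproot (toS t) ≡ forest t
  uproot-toS (chain0 l)       = refl
  uproot-toS (chain1 l t)     = refl
  uproot-toS (junction c a b) with tailForest a
  ... | []    = refl
  ... | _ ∷ _ = refl

  toY-toS : ∀ {t} → Canonical t → toY (toS t) ≡ t
  toY-toS {t} ct =
    cong (fromMaybe (chain0 0)) (≡-trans (cong (fromForest id) (uproot-toS t)) (fromForest-forest ct))

  slabelsL-forest : ∀ t → slabelsL (forest t) ↭ ylabels t
  slabelsL-forest (chain0 l)       = refl
  slabelsL-forest (chain1 l t)     = prep l (slabelsL-forest t)
  slabelsL-forest (junction c a b) = begin
    (slabels (recolour (up c) (headTree a)) ++ slabelsL (recolourF (up c) (forest b)))
      ++ slabelsL (tailForest a)
      ≡⟨ cong (_++ slabelsL (tailForest a)) (cong₂ _++_ (slabels-recolour (up c) (headTree a))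
                                                          (slabelsL-recolourF (up c) (forest b))) ⟩
    (slabels (headTree a) ++ slabelsL (forest b)) ++ slabelsL (tailForest a)
      ↭⟨ ++-swapʳ (slabels (headTree a)) (slabelsL (forest b)) (slabelsL (tailForest a)) ⟩
    slabelsL (forest a) ++ slabelsL (forest b)
      ↭⟨ ++⁺ (slabelsL-forest a) (slabelsL-forest b) ⟩
    ylabels a ++ ylabels b ∎
    where open PermutationReasoning

  Child₀ : S → Set
  Child₀ t = SWellFormed t × ColorDiff zero t

  All-Child₀-forest : ∀ t → All Child₀ (forest t)
  All-Child₀-forest (chain0 l)       = (leaf , leaf) ∷ []
  All-Child₀-forest (chain1 l t)     = (leaf , leaf) ∷ All-Child₀-forest t
  All-Child₀-forest (junction c a b) with All-Child₀-forest a | All-Child₀-forest b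
  ... | (wa , da) ∷ tail-a | forest-b = (new-node , node λ ()) ∷ tail-a
    where
    new-node : SWellFormed (headTree (junction c a b))
    new-node = node (s≤s (s≤s z≤n))
      (ColorDiff-recolour (up-injective c) da ∷ All-ColorDiff-recolourF (up-injective c) (All.map proj₂ forest-b))
      (SWellFormed-recolour (up-injective c) wa ∷ All-SWellFormed-recolourF (up-injective c) (All.map proj₁ forest-b))

  SWellFormed-plant : ∀ {t ts} → All Child₀ (t ∷ ts) → SWellFormed (plant (t ∷ ts))
  SWellFormed-plant {ts = []}    ((w , _) ∷ []) = w
  SWellFormed-plant {ts = _ ∷ _} cs             =
    node (s≤s (s≤s z≤n)) (All.map proj₂ cs) (All.map proj₁ cs)

  slabels-plant : ∀ t ts → slabels (plant (t ∷ ts)) ↭ slabelsL (t ∷ ts)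
  slabels-plant t []      = ↭-sym (++-identityʳ (slabels t))
  slabels-plant t (_ ∷ _) = refl

  toS-valid : ∀ {s} t → ylabels t ↭ labelSet s → IsSTree (suc k) s (toS t)
  toS-valid t p = ↭-trans (slabels-plant (headTree t) (tailForest t)) (↭-trans (slabelsL-forest t) p)
                      , SWellFormed-plant (All-Child₀-forest t)

  insertBelow-replaceRest : ∀ σ x z r →
                            insertBelow σ x (replaceRest z r) ≡ replaceRest z (just (insertM σ x r))
  insertBelow-replaceRest σ x (chain0 l)       nothing  = refl
  insertBelow-replaceRest σ x (chain0 l)       (just _) = refl
  insertBelow-replaceRest σ x (chain1 l _)     nothing  = refl
  insertBelow-replaceRest σ x (chain1 l _)     (just _) = refl
  insertBelow-replaceRest σ x (junction c a b) r =
    cong (λ a′ → junction c a′ b) (insertBelow-replaceRest σ x a r)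

  insertBelow-fromTree : ∀ σ x y r → insertBelow σ x (fromTree σ y r) ≡ fromTree σ y (just (insertM σ x r))
  insertBelow-fromTree σ x y r = begin
    insertBelow σ x (fromTree σ y r)
      ≡⟨ cong (insertBelow σ x) (fromTree-replaceRest σ y r) ⟩
    insertBelow σ x (replaceRest (fromTree σ y nothing) r)
      ≡⟨ insertBelow-replaceRest σ x (fromTree σ y nothing) r ⟩
    replaceRest (fromTree σ y nothing) (just (insertM σ x r))
      ≡⟨ sym (fromTree-replaceRest σ y _) ⟩
    fromTree σ y (just (insertM σ x r))
      ∎
    where open ≡.≡-Reasoning

  insert-fromTree-< : ∀ σ x y r → minS x < minS y →
                      insert σ x (fromTree σ y r) ≡ fromTree σ x (just (fromTree σ y r))
  insert-fromTree-< σ x y r x<y = insert-< σ x _ (subst (minS x <_) (sym (minY-fromTree σ y r)) x<y)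

  insert-fromTree-> : ∀ σ x y r → minS x < minS y →
                      insert σ y (fromTree σ x r) ≡ fromTree σ x (just (insertM σ y r))
  insert-fromTree-> σ x y r x<y =
    ≡-trans (insert-≮ σ y _ (<-asym x<y ∘ subst (minS y <_) (minY-fromTree σ x r)))
            (insertBelow-fromTree σ y x r)

  insert-fromTree-comm : ∀ σ x y → minS x ≢ minS y →
                         insert σ x (fromTree σ y nothing) ≡ insert σ y (fromTree σ x nothing)
  insert-fromTree-comm σ x y x≢y with <-cmp (minS x) (minS y)
  ... | tri< x<y _ _ =
    ≡-trans (insert-fromTree-< σ x y nothing x<y) (sym (insert-fromTree-> σ x y nothing x<y))
  ... | tri≈ _ x≡y _ = contradiction x≡y x≢y
  ... | tri> _ _ y<x =
    ≡-trans (insert-fromTree-> σ y x nothing y<x) (sym (insert-fromTree-< σ y x nothing y<x))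

  insert-insert-< : ∀ σ x y r → minS x < minS y → minS x < minY r →
                    insert σ x (insert σ y r) ≡ insert σ y (insert σ x r)
  insert-insert-< σ x y r x<y x<r = begin
    insert σ x (insert σ y r)
      ≡⟨ insert-< σ x _ (subst (minS x <_) (sym (minY-insert σ y r)) (⊓-glb x<y x<r)) ⟩
    fromTree σ x (just (insert σ y r))
      ≡⟨ sym (insert-fromTree-> σ x y (just r) x<y) ⟩
    insert σ y (fromTree σ x (just r))
      ≡⟨ cong (insert σ y) (sym (insert-< σ x r x<r)) ⟩
    insert σ y (insert σ x r)
      ∎
    where open ≡.≡-Reasoning

  mutual
    insert-comm : ∀ σ x y r → minS x ≢ minS y →
                  insert σ x (insert σ y r) ≡ insert σ y (insert σ x r)
    insert-comm σ x y r x≢y with <-cmp (minS x) (minS y)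
    ... | tri< x<y _ _ = insert-comm-< σ x y r x<y
    ... | tri≈ _ x≡y _ = contradiction x≡y x≢y
    ... | tri> _ _ y<x = sym (insert-comm-< σ y x r y<x)

    insert-comm-< : ∀ σ x y r → minS x < minS y →
                    insert σ x (insert σ y r) ≡ insert σ y (insert σ x r)
    insert-comm-< σ x y r x<y with toSum (minS x <? minY r)
    ... | inj₁ x<r = insert-insert-< σ x y r x<y x<r
    ... | inj₂ x≮r = begin
      insert σ x (insert σ y r)
        ≡⟨ cong (insert σ x) (insert-≮ σ y r y≮r) ⟩
      insert σ x (insertBelow σ y r)
        ≡⟨ insert-≮ σ x _ (subst (λ v → ¬ minS x < v) (sym (minY-insertBelow σ y r)) x≮r) ⟩
      insertBelow σ x (insertBelow σ y r)
        ≡⟨ insertBelow-comm σ x y r (<⇒≢ x<y) ⟩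
      insertBelow σ y (insertBelow σ x r)
        ≡⟨ sym (insert-≮ σ y _ (subst (λ v → ¬ minS y < v) (sym (minY-insertBelow σ x r)) y≮r)) ⟩
      insert σ y (insertBelow σ x r)
        ≡⟨ cong (insert σ y) (sym (insert-≮ σ x r x≮r)) ⟩
      insert σ y (insert σ x r)
        ∎
      where
      open ≡.≡-Reasoning
      y≮r : ¬ minS y < minY r
      y≮r = x≮r ∘ <-trans x<y

    insertBelow-comm : ∀ σ x y r → minS x ≢ minS y →
                       insertBelow σ x (insertBelow σ y r) ≡ insertBelow σ y (insertBelow σ x r)
    insertBelow-comm σ x y (chain0 l)       x≢y = cong (chain1 l) (insert-fromTree-comm σ x y x≢y)
    insertBelow-comm σ x y (chain1 l u)     x≢y = cong (chain1 l) (insert-comm σ x y u x≢y)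
    insertBelow-comm σ x y (junction c a b) x≢y =
      cong (λ a′ → junction c a′ b) (insertBelow-comm σ x y a x≢y)

  insert-insertM-comm : ∀ σ x y r → minS x ≢ minS y →
                        insert σ x (insertM σ y r) ≡ insert σ y (insertM σ x r)
  insert-insertM-comm σ x y nothing  = insert-fromTree-comm σ x y
  insert-insertM-comm σ x y (just r) = insert-comm σ x y r

  fromForest-↭ : ∀ σ {ts us} → ts ↭ us → DistinctMins ts → fromForest σ ts ≡ fromForest σ us
  fromForest-↭ σ refl         _       = refl
  fromForest-↭ σ (prep t p)   (_ ∷ d) = cong (just ∘ insertM σ t) (fromForest-↭ σ p d)
  fromForest-↭ σ {us = _ ∷ _ ∷ us} (swap t u p) ((t≢u ∷ _) ∷ _ ∷ d) = cong just (≡-trans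
    (cong (insert σ t ∘ insertM σ u) (fromForest-↭ σ p d))
    (insert-insertM-comm σ t u (fromForest σ us) t≢u))
  fromForest-↭ σ (trans p q)  d       =
    ≡-trans (fromForest-↭ σ p d) (fromForest-↭ σ q (DistinctMins-resp-↭ p d))

  mutual
    fromTree-≅S : ∀ σ {t u} → t ≅S u → DistinctChildMins t → ∀ r → fromTree σ t r ≡ fromTree σ u r
    fromTree-≅S σ leaf                    _           r = refl
    fromTree-≅S σ {node c _} (node ts≅us) (node d ds) r = fromNode-≅F (σ c) σ ts≅us d ds r

    fromNode-≅F : ∀ x σ {ts us} → ts ≅F us → DistinctMins ts → All DistinctChildMins ts →
                  ∀ r → fromNode x σ ts r ≡ fromNode x σ us r
    fromNode-≅F zero    σ {ts} {us} ts≅us d ds r = cong (λ l → chain l r) (begin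
      minF ts
        ≡⟨ sym (minY-fromForest σ ts) ⟩
      minY (fromMaybe (chain0 0) (fromForest σ ts))
        ≡⟨ cong (minY ∘ fromMaybe (chain0 0)) (fromForest-≅F σ ts≅us d ds) ⟩
      minY (fromMaybe (chain0 0) (fromForest σ us))
        ≡⟨ minY-fromForest σ us ⟩
      minF us
        ∎)
      where open ≡.≡-Reasoning
    fromNode-≅F (suc c) σ ts≅us d ds r =
      cong (λ z → fromJunction c z r) (fromForest-≅F (down c ∘ σ) ts≅us d ds)

    fromForest-≅F : ∀ σ {ts us} → ts ≅F us → DistinctMins ts → All DistinctChildMins ts →
                    fromForest σ ts ≡ fromForest σ us
    fromForest-≅F σ (_ , p , rs) d ds =
      ≡-trans (fromForest-↭ σ p d) (fromForest-Pointwise σ rs (All-resp-↭ p ds))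

    fromForest-Pointwise : ∀ σ {ts us} → Pointwise _≅S_ ts us → All DistinctChildMins ts →
                           fromForest σ ts ≡ fromForest σ us
    fromForest-Pointwise σ []       []       = refl
    fromForest-Pointwise σ {t ∷ _} {_ ∷ us} (t≅u ∷ rs) (d ∷ ds) = cong just (≡-trans
      (cong (insertM σ t) (fromForest-Pointwise σ rs ds)) (insertM-≅S σ t≅u d (fromForest σ us)))

    insertM-≅S : ∀ σ {t u} → t ≅S u → DistinctChildMins t → ∀ r → insertM σ t r ≡ insertM σ u r
    insertM-≅S σ t≅u d nothing  = fromTree-≅S σ t≅u d nothing
    insertM-≅S σ t≅u d (just r) = insert-≅S σ t≅u d r

    minS-≅S : ∀ σ {t u} → t ≅S u → DistinctChildMins t → minS t ≡ minS u
    minS-≅S σ {t} {u} t≅u d = begin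
      minS t                       ≡⟨ sym (minY-fromTree σ t nothing) ⟩
      minY (fromTree σ t nothing)  ≡⟨ cong minY (fromTree-≅S σ t≅u d nothing) ⟩
      minY (fromTree σ u nothing)  ≡⟨ minY-fromTree σ u nothing ⟩
      minS u                       ∎
      where open ≡.≡-Reasoning

    insert-≅S : ∀ σ {t u} → t ≅S u → DistinctChildMins t → ∀ r → insert σ t r ≡ insert σ u r
    insert-≅S σ {t} {u} t≅u d r with toSum (minS t <? minY r)
    ... | inj₁ t<r = begin
      insert σ t r
        ≡⟨ insert-< σ t r t<r ⟩
      fromTree σ t (just r)
        ≡⟨ fromTree-≅S σ t≅u d (just r) ⟩
      fromTree σ u (just r)
        ≡⟨ sym (insert-< σ u r (subst (_< minY r) (minS-≅S σ t≅u d) t<r)) ⟩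
      insert σ u r
        ∎
      where open ≡.≡-Reasoning
    ... | inj₂ t≮r = begin
      insert σ t r
        ≡⟨ insert-≮ σ t r t≮r ⟩
      insertBelow σ t r
        ≡⟨ insertBelow-≅S σ t≅u d r ⟩
      insertBelow σ u r
        ≡⟨ sym (insert-≮ σ u r (subst (λ v → ¬ v < minY r) (minS-≅S σ t≅u d) t≮r)) ⟩
      insert σ u r
        ∎
      where open ≡.≡-Reasoning

    insertBelow-≅S : ∀ σ {t u} → t ≅S u → DistinctChildMins t → ∀ r →
                     insertBelow σ t r ≡ insertBelow σ u r
    insertBelow-≅S σ t≅u d (chain0 l)       = cong (chain1 l) (fromTree-≅S σ t≅u d nothing)
    insertBelow-≅S σ t≅u d (chain1 l v)     = cong (chain1 l) (insert-≅S σ t≅u d v)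
    insertBelow-≅S σ t≅u d (junction c a b) = cong (λ a′ → junction c a′ b) (insertBelow-≅S σ t≅u d a)

  toY-≅S : ∀ {t u} → t ≅S u → DistinctChildMins t → toY t ≡ toY u
  toY-≅S leaf                         _           = refl
  toY-≅S {node zero _}    (node ts≅us) (node d ds) = cong (fromMaybe (chain0 0)) (fromForest-≅F id ts≅us d ds)
  toY-≅S {node (suc c) _} t≅u@(node _) d           = fromTree-≅S id t≅u d nothing

  NonZeroRoot : Colouring → S → Set
  NonZeroRoot σ (leaf _)   = ⊤
  NonZeroRoot σ (node c _) = σ c ≢ zero

  NonZeroRoot-down : ∀ σ → Injective _≡_ _≡_ σ → ∀ {q c} → σ q ≡ suc c →
                     ∀ {t} → ColorDiff q t → NonZeroRoot (down c ∘ σ) t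
  NonZeroRoot-down σ σ-inj σq≡         leaf          = tt
  NonZeroRoot-down σ σ-inj {c = c} σq≡ (node q≢q′) e =
    q≢q′ (σ-inj (≡-trans σq≡ (down-injective c (≡-trans (down-up c zero) (sym e)))))

  NonZeroRoot-id : ∀ {t} → ColorDiff zero t → NonZeroRoot id t
  NonZeroRoot-id leaf      = tt
  NonZeroRoot-id (node 0≢) = 0≢ ∘ sym

  restOf-insertBelow : ∀ σ t r → Σ Y λ w → restOf (insertBelow σ t r) ≡ just w
  restOf-insertBelow σ t (chain0 l)       = _ , refl
  restOf-insertBelow σ t (chain1 l u)     = _ , refl
  restOf-insertBelow σ t (junction c a b) = restOf-insertBelow σ t a

  restOf-insert : ∀ σ t r → Σ Y λ w → restOf (insert σ t r) ≡ just w
  restOf-insert σ t r with minS t <? minY r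
  ... | yes _ = r , restOf-fromTree σ t (just r)
  ... | no _  = restOf-insertBelow σ t r

  ≅F-isPreorder : IsPreorder _≡_ (_≅F_ {m = suc k})
  ≅F-isPreorder = record
    { isEquivalence = ≡.isEquivalence
    ; reflexive     = ≅F-refl′
    ; trans         = ≅F-trans
    }

  module ≅F-Reasoning = PreorderReasoning ≅F-isPreorder

  mutual
    forest-fromTree : ∀ σ → Injective _≡_ _≡_ σ → ∀ t → SWellFormed t → NonZeroRoot σ t →
                      ∀ r → recolour σ t ∷ forestM r ≅F forest (fromTree σ t r)
    forest-fromTree σ σ-inj (leaf l)    w nz nothing  = ≅F-refl _
    forest-fromTree σ σ-inj (leaf l)    w nz (just _) = ≅F-refl _
    forest-fromTree σ σ-inj (node q ts) w nz r        = forest-fromNode σ σ-inj q ts w (σ q) refl nz r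

    forest-fromNode : ∀ σ → Injective _≡_ _≡_ σ → ∀ q ts → SWellFormed (node q ts) →
                      ∀ x → σ q ≡ x → σ q ≢ zero →
                      ∀ r → node (σ q) (recolourF σ ts) ∷ forestM r ≅F forest (fromNode x σ ts r)
    forest-fromNode σ σ-inj q ts       w                   zero    σq≡ σq≢0 r =
      contradiction σq≡ σq≢0
    forest-fromNode σ σ-inj q []       (node () _ _)       (suc c) _   _    r
    forest-fromNode σ σ-inj q (_ ∷ []) (node (s≤s ()) _ _) (suc c) _   _    r
    forest-fromNode σ σ-inj q ts@(t ∷ u ∷ us) (node _ ds ws) (suc c) σq≡ _ r
      with restOf-insert (down c ∘ σ) t (insertM (down c ∘ σ) u (fromForest (down c ∘ σ) us))
    ... | w , restOf≡ = ≅F-∷ root≅ (≅F-refl′ (sym (tailForest-replaceRest z r)))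
      where
      σ′ : Colouring
      σ′ = down c ∘ σ
      z : Y
      z = insert σ′ t (insertM σ′ u (fromForest σ′ us))
      children≅ : recolourF σ ts ≅F recolourF (up c) (headTree (replaceRest z r) ∷ forest (fromMaybe z (restOf z)))
      children≅ = begin
        recolourF σ ts
          ≡⟨ sym (≡-trans (recolourF-∘ (up c) σ′ ts) (recolourF-cong (up-down c ∘ σ) ts)) ⟩
        recolourF (up c) (recolourF σ′ ts)
          ≲⟨ recolourF-≅F (up c) (forest-fromForest σ′ (λ e → σ-inj (down-injective c e)) ts ws
                                                     (All.map (NonZeroRoot-down σ σ-inj σq≡) ds)) ⟩
        recolourF (up c) (headTree z ∷ tailForest z)
          ≡⟨ cong (recolourF (up c)) (cong₂ _∷_ (sym (headTree-replaceRest z r)) (begin-equality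
               tailForest z                          ≡⟨ tailForest-restOf z ⟩
               forestM (restOf z)                    ≡⟨ cong forestM restOf≡ ⟩
               forest w                              ≡⟨ cong (forest ∘ fromMaybe z) (sym restOf≡) ⟩
               forest (fromMaybe z (restOf z))       ∎)) ⟩
        recolourF (up c) (headTree (replaceRest z r) ∷ forest (fromMaybe z (restOf z))) ∎
        where open ≅F-Reasoning
      root≅ : node (σ q) (recolourF σ ts) ≅S headTree (fromNode (suc c) σ ts r)
      root≅ = subst (λ x → node x (recolourF σ ts) ≅S headTree (fromNode (suc c) σ ts r)) (sym σq≡)
                    (node children≅)

    forest-fromForest : ∀ σ → Injective _≡_ _≡_ σ → ∀ ts → All SWellFormed ts →
                        All (NonZeroRoot σ) ts → recolourF σ ts ≅F forestM (fromForest σ ts)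
    forest-fromForest σ σ-inj []       _        _          = ≅F-refl []
    forest-fromForest σ σ-inj (t ∷ ts) (w ∷ ws) (nz ∷ nzs) =
      ≅F-trans (≅F-∷ (≅S-refl _) (forest-fromForest σ σ-inj ts ws nzs))
               (forest-insertM σ σ-inj t w nz (fromForest σ ts))

    forest-insertM : ∀ σ → Injective _≡_ _≡_ σ → ∀ t → SWellFormed t → NonZeroRoot σ t →
                     ∀ r → recolour σ t ∷ forestM r ≅F forest (insertM σ t r)
    forest-insertM σ σ-inj t w nz nothing  = forest-fromTree σ σ-inj t w nz nothing
    forest-insertM σ σ-inj t w nz (just r) = forest-insert σ σ-inj t w nz r

    forest-insert : ∀ σ → Injective _≡_ _≡_ σ → ∀ t → SWellFormed t → NonZeroRoot σ t →
                    ∀ r → recolour σ t ∷ forest r ≅F forest (insert σ t r)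
    forest-insert σ σ-inj t w nz r with toSum (minS t <? minY r)
    ... | inj₁ t<r = subst (recolour σ t ∷ forest r ≅F_) (cong forest (sym (insert-< σ t r t<r)))
                           (forest-fromTree σ σ-inj t w nz (just r))
    ... | inj₂ t≮r with forest-insertBelow σ σ-inj t w nz r
    ...   | headTree≡ , tail≅ = begin
      recolour σ t ∷ headTree r ∷ tailForest r
        ≲⟨ ↭⇒≅F (swap _ _ refl) ⟩
      headTree r ∷ recolour σ t ∷ tailForest r
        ≲⟨ ≅F-∷ (≅S-refl _) tail≅ ⟩
      headTree r ∷ tailForest (insertBelow σ t r)
        ≡⟨ cong (_∷ tailForest (insertBelow σ t r)) (sym headTree≡) ⟩
      forest (insertBelow σ t r)
        ≡⟨ cong forest (sym (insert-≮ σ t r t≮r)) ⟩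
      forest (insert σ t r)
        ∎
      where open ≅F-Reasoning

    forest-insertBelow : ∀ σ → Injective _≡_ _≡_ σ → ∀ t → SWellFormed t → NonZeroRoot σ t →
                         ∀ r → headTree (insertBelow σ t r) ≡ headTree r ×
                         recolour σ t ∷ tailForest r ≅F tailForest (insertBelow σ t r)
    forest-insertBelow σ σ-inj t w nz (chain0 l)       = refl , forest-fromTree σ σ-inj t w nz nothing
    forest-insertBelow σ σ-inj t w nz (chain1 l u)     = refl , forest-insert σ σ-inj t w nz u
    forest-insertBelow σ σ-inj t w nz (junction c a b) with forest-insertBelow σ σ-inj t w nz a
    ... | headTree≡ , tail≅ =
      cong (λ h → node (suc c) (recolour (up c) h ∷ recolourF (up c) (forest b))) headTree≡ , tail≅

  ≅S-plant : ∀ {t ts us} → t ∷ ts ≅F us → plant (t ∷ ts) ≅S plant us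
  ≅S-plant {ts = []}    {[]}          p with ≅F-length p
  ... | ()
  ≅S-plant {ts = []}    {u ∷ []}      (_ , p , r ∷ []) with ∈-resp-↭ p (here refl)
  ... | here refl = r
  ≅S-plant {ts = []}    {_ ∷ _ ∷ _}   p with ≅F-length p
  ... | ()
  ≅S-plant {ts = _ ∷ _} {[]}          p with ≅F-length p
  ... | ()
  ≅S-plant {ts = _ ∷ _} {_ ∷ []}      p with ≅F-length p
  ... | ()
  ≅S-plant {ts = _ ∷ _} {_ ∷ _ ∷ _}   p = node p

  forest-toY : ∀ t ts → All SWellFormed (t ∷ ts) → All (NonZeroRoot id) (t ∷ ts) →
               t ∷ ts ≅F forestM (fromForest id (t ∷ ts))
  forest-toY t ts ws nzs = subst (_≅F forestM (fromForest id (t ∷ ts))) (recolourF-id (t ∷ ts))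
                                 (forest-fromForest id (λ e → e) (t ∷ ts) ws nzs)

  toS-toY : ∀ {t} → SWellFormed t → t ≅S toS (toY t)
  toS-toY {leaf l}                 w                   = ≅S-plant (forest-toY (leaf l) [] (w ∷ []) (tt ∷ []))
  toS-toY {node (suc c) ts}        w                   =
    ≅S-plant (forest-toY (node (suc c) ts) [] (w ∷ []) ((λ ()) ∷ []))
  toS-toY {node zero []}           (node () _ _)
  toS-toY {node zero (_ ∷ [])}     (node (s≤s ()) _ _)
  toS-toY {node zero (t ∷ u ∷ ts)} (node _ ds ws)      =
    ≅S-plant (forest-toY t (u ∷ ts) ws (All.map NonZeroRoot-id ds))

  mutual
    ylabels-fromTree : ∀ σ → Injective _≡_ _≡_ σ → ∀ t → SWellFormed t → NonZeroRoot σ t →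
                       ∀ r → ylabels (fromTree σ t r) ↭ slabels t ++ ylabelsM r
    ylabels-fromTree σ σ-inj (leaf l)    w nz nothing  = refl
    ylabels-fromTree σ σ-inj (leaf l)    w nz (just _) = refl
    ylabels-fromTree σ σ-inj (node q ts) w nz r        = ylabels-fromNode σ σ-inj q ts w (σ q) refl nz r

    ylabels-fromNode : ∀ σ → Injective _≡_ _≡_ σ → ∀ q ts → SWellFormed (node q ts) →
                       ∀ x → σ q ≡ x → σ q ≢ zero →
                       ∀ r → ylabels (fromNode x σ ts r) ↭ slabelsL ts ++ ylabelsM r
    ylabels-fromNode σ σ-inj q ts       w                   zero    σq≡ σq≢0 r =
      contradiction σq≡ σq≢0
    ylabels-fromNode σ σ-inj q []       (node () _ _)       (suc c) _   _    r
    ylabels-fromNode σ σ-inj q (_ ∷ []) (node (s≤s ()) _ _) (suc c) _   _    r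
    ylabels-fromNode σ σ-inj q ts@(t ∷ u ∷ us) (node _ ds ws) (suc c) σq≡ _ r
      with restOf-insert (down c ∘ σ) t (insertM (down c ∘ σ) u (fromForest (down c ∘ σ) us))
    ... | w , restOf≡ = begin
      ylabels (replaceRest z r) ++ ylabels (fromMaybe z (restOf z))
        ≡⟨ cong (λ v → ylabels (replaceRest z r) ++ ylabels (fromMaybe z v)) restOf≡ ⟩
      ylabels (replaceRest z r) ++ ylabels w
        ↭⟨ ++⁺ʳ (ylabels w) (ylabels-replaceRest z r) ⟩
      (ylabels (replaceRest z nothing) ++ ylabelsM r) ++ ylabels w
        ↭⟨ ++-swapʳ (ylabels (replaceRest z nothing)) (ylabelsM r) (ylabels w) ⟩
      (ylabels (replaceRest z nothing) ++ ylabels w) ++ ylabelsM r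
        ≡⟨ cong (λ v → (ylabels (replaceRest z nothing) ++ ylabelsM v) ++ ylabelsM r) (sym restOf≡) ⟩
      (ylabels (replaceRest z nothing) ++ ylabelsM (restOf z)) ++ ylabelsM r
        ↭⟨ ++⁺ʳ (ylabelsM r) (↭-sym (ylabels-restOf z)) ⟩
      ylabels z ++ ylabelsM r
        ↭⟨ ++⁺ʳ (ylabelsM r) (ylabelsM-fromForest σ′ (λ e → σ-inj (down-injective c e)) ts ws
                                                 (All.map (NonZeroRoot-down σ σ-inj σq≡) ds)) ⟩
      slabelsL ts ++ ylabelsM r ∎
      where
      open PermutationReasoning
      σ′ : Colouring
      σ′ = down c ∘ σ
      z : Y
      z = insert σ′ t (insertM σ′ u (fromForest σ′ us))

    ylabelsM-fromForest : ∀ σ → Injective _≡_ _≡_ σ → ∀ ts → All SWellFormed ts →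
                          All (NonZeroRoot σ) ts → ylabelsM (fromForest σ ts) ↭ slabelsL ts
    ylabelsM-fromForest σ σ-inj []       _        _          = refl
    ylabelsM-fromForest σ σ-inj (t ∷ ts) (w ∷ ws) (nz ∷ nzs) =
      ↭-trans (ylabels-insertM σ σ-inj t w nz (fromForest σ ts))
              (++⁺ˡ (slabels t) (ylabelsM-fromForest σ σ-inj ts ws nzs))

    ylabels-insertM : ∀ σ → Injective _≡_ _≡_ σ → ∀ t → SWellFormed t → NonZeroRoot σ t →
                      ∀ r → ylabels (insertM σ t r) ↭ slabels t ++ ylabelsM r
    ylabels-insertM σ σ-inj t w nz nothing  = ylabels-fromTree σ σ-inj t w nz nothing
    ylabels-insertM σ σ-inj t w nz (just r) = ylabels-insert σ σ-inj t w nz r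

    ylabels-insert : ∀ σ → Injective _≡_ _≡_ σ → ∀ t → SWellFormed t → NonZeroRoot σ t →
                     ∀ r → ylabels (insert σ t r) ↭ slabels t ++ ylabels r
    ylabels-insert σ σ-inj t w nz r with toSum (minS t <? minY r)
    ... | inj₁ t<r = subst (λ v → ylabels v ↭ slabels t ++ ylabels r) (sym (insert-< σ t r t<r))
                           (ylabels-fromTree σ σ-inj t w nz (just r))
    ... | inj₂ t≮r = subst (λ v → ylabels v ↭ slabels t ++ ylabels r) (sym (insert-≮ σ t r t≮r))
                           (ylabels-insertBelow σ σ-inj t w nz r)

    ylabels-insertBelow : ∀ σ → Injective _≡_ _≡_ σ → ∀ t → SWellFormed t → NonZeroRoot σ t →
                          ∀ r → ylabels (insertBelow σ t r) ↭ slabels t ++ ylabels r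
    ylabels-insertBelow σ σ-inj t w nz (chain0 l) =
      ↭-trans (prep l (ylabels-fromTree σ σ-inj t w nz nothing)) (↭-sym (shift l (slabels t) []))
    ylabels-insertBelow σ σ-inj t w nz (chain1 l u) =
      ↭-trans (prep l (ylabels-insert σ σ-inj t w nz u)) (↭-sym (shift l (slabels t) (ylabels u)))
    ylabels-insertBelow σ σ-inj t w nz (junction c a b) =
      ↭-trans (++⁺ʳ (ylabels b) (ylabels-insertBelow σ σ-inj t w nz a))
              (++-assoc (slabels t) (ylabels a) (ylabels b))

  mutual
    Canonical-fromTree : ∀ σ → Injective _≡_ _≡_ σ → ∀ t → SWellFormed t → NonZeroRoot σ t →
                         Unique (slabels t) → ∀ r → CanonicalM r → All (minS t <_) (ylabelsM r) →
                         Canonical (fromTree σ t r)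
    Canonical-fromTree σ σ-inj (leaf l)    w nz u nothing  _  _  = tt
    Canonical-fromTree σ σ-inj (leaf l)    w nz u (just _) cr t< = t< , cr
    Canonical-fromTree σ σ-inj (node q ts) w nz u r        cr t< =
      Canonical-fromNode σ σ-inj q ts w (σ q) refl nz u r cr t<

    Canonical-fromNode : ∀ σ → Injective _≡_ _≡_ σ → ∀ q ts → SWellFormed (node q ts) →
                         ∀ x → σ q ≡ x → σ q ≢ zero →
                         Unique (slabelsL ts) → ∀ r → CanonicalM r → All (minF ts <_) (ylabelsM r) →
                         Canonical (fromNode x σ ts r)
    Canonical-fromNode σ σ-inj q ts       w                   zero    σq≡ σq≢0 _ r _ _ =
      contradiction σq≡ σq≢0
    Canonical-fromNode σ σ-inj q []       (node () _ _)       (suc c) _   _    _ r _ _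
    Canonical-fromNode σ σ-inj q (_ ∷ []) (node (s≤s ()) _ _) (suc c) _   _    _ r _ _
    Canonical-fromNode σ σ-inj q ts@(t ∷ u ∷ us) (node _ ds ws) (suc c) σq≡ _ uniq r cr ts<
      with restOf-insert (down c ∘ σ) t (insertM (down c ∘ σ) u (fromForest (down c ∘ σ) us))
    ... | w , restOf≡ =
      subst (λ v → Canonical (junction c (replaceRest z r) (fromMaybe z v))) (sym restOf≡)
            (z<w , cz′ , cw)
      where
      σ′ : Colouring
      σ′ = down c ∘ σ
      z : Y
      z = insert σ′ t (insertM σ′ u (fromForest σ′ us))
      cz : Canonical z
      cz = CanonicalM-fromForest σ′ (λ e → σ-inj (down-injective c e)) ts ws
                                 (All.map (NonZeroRoot-down σ σ-inj σq≡) ds) uniq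
      cw : Canonical w
      cw = subst CanonicalM restOf≡ (CanonicalM-restOf cz)
      z<w : minY (replaceRest z r) < minY w
      z<w = subst (_< minY w) (sym (minY-replaceRest z r))
              (lookupAll (subst (λ v → All (minY z <_) (ylabelsM v)) restOf≡ (minY<ylabelsM-restOf cz))
                         (minY∈ylabels w))
      cz′ : Canonical (replaceRest z r)
      cz′ = Canonical-replaceRest cz r cr
              (subst (λ v → All (v <_) (ylabelsM r)) (sym (minY-insertM-fromForest σ′ t (u ∷ us))) ts<)

    CanonicalM-fromForest : ∀ σ → Injective _≡_ _≡_ σ → ∀ ts → All SWellFormed ts →
                            All (NonZeroRoot σ) ts → Unique (slabelsL ts) → CanonicalM (fromForest σ ts)
    CanonicalM-fromForest σ σ-inj []       _        _          _ = tt
    CanonicalM-fromForest σ σ-inj (t ∷ ts) (w ∷ ws) (nz ∷ nzs) u with Unique-++⁻ (slabels t) u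
    ... | ut , uts , disjoint =
      Canonical-insertM σ σ-inj t w nz ut (fromForest σ ts) (CanonicalM-fromForest σ σ-inj ts ws nzs uts)
        (disjoint (minS∈slabels w) ∘ ∈-resp-↭ (ylabelsM-fromForest σ σ-inj ts ws nzs))

    Canonical-insertM : ∀ σ → Injective _≡_ _≡_ σ → ∀ t → SWellFormed t → NonZeroRoot σ t →
                        Unique (slabels t) → ∀ r → CanonicalM r → minS t ∉ ylabelsM r →
                        Canonical (insertM σ t r)
    Canonical-insertM σ σ-inj t w nz u nothing  _  _  = Canonical-fromTree σ σ-inj t w nz u nothing tt []
    Canonical-insertM σ σ-inj t w nz u (just r) cr t∉ = Canonical-insert σ σ-inj t w nz u r cr t∉

    Canonical-insert : ∀ σ → Injective _≡_ _≡_ σ → ∀ t → SWellFormed t → NonZeroRoot σ t →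
                       Unique (slabels t) → ∀ r → Canonical r → minS t ∉ ylabels r →
                       Canonical (insert σ t r)
    Canonical-insert σ σ-inj t w nz u r cr t∉ with toSum (minS t <? minY r)
    ... | inj₁ t<r = subst Canonical (sym (insert-< σ t r t<r))
      (Canonical-fromTree σ σ-inj t w nz u (just r) cr (All.map (<-≤-trans t<r) (minY≤ylabels cr)))
    ... | inj₂ t≮r = subst Canonical (sym (insert-≮ σ t r t≮r))
      (Canonical-insertBelow σ σ-inj t w nz u r cr r<t t∉)
      where
      r<t : minY r < minS t
      r<t = ≤∧≢⇒< (≮⇒≥ t≮r) (λ e → t∉ (subst (_∈ ylabels r) e (minY∈ylabels r)))

    Canonical-insertBelow : ∀ σ → Injective _≡_ _≡_ σ → ∀ t → SWellFormed t → NonZeroRoot σ t →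
                            Unique (slabels t) → ∀ r → Canonical r → minY r < minS t → minS t ∉ ylabels r →
                            Canonical (insertBelow σ t r)
    Canonical-insertBelow σ σ-inj t w nz u (chain0 l) _ l<t _ =
      All-resp-↭ (↭-sym (↭-trans (ylabels-fromTree σ σ-inj t w nz nothing) (++-identityʳ (slabels t))))
                 (All.map (<-≤-trans l<t) (minS≤slabels t))
      , Canonical-fromTree σ σ-inj t w nz u nothing tt []
    Canonical-insertBelow σ σ-inj t w nz u (chain1 l v) (l<v , cv) l<t t∉ =
      All-resp-↭ (↭-sym (ylabels-insert σ σ-inj t w nz v))
                 (AllProps.++⁺ (All.map (<-≤-trans l<t) (minS≤slabels t)) l<v)
      , Canonical-insert σ σ-inj t w nz u v cv (t∉ ∘ there)
    Canonical-insertBelow σ σ-inj t w nz u (junction c a b) (a<b , ca , cb) a<t t∉ =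
      subst (_< minY b) (sym (minY-insertBelow σ t a)) a<b
      , Canonical-insertBelow σ σ-inj t w nz u a ca a<t (t∉ ∘ ∈-++⁺ˡ) , cb

  uproot-valid : ∀ {t} → SWellFormed t → All SWellFormed (uproot t) × All (NonZeroRoot id) (uproot t) ×
                                          slabelsL (uproot t) ↭ slabels t
  uproot-valid {leaf l}          w              = w ∷ [] , tt ∷ [] , refl
  uproot-valid {node (suc c) ts} w              = w ∷ [] , (λ ()) ∷ [] , ++-identityʳ (slabelsL ts)
  uproot-valid {node zero ts}    (node _ ds ws) = ws , All.map NonZeroRoot-id ds , refl

  fromForest-uproot : ∀ {t} → SWellFormed t → fromForest id (uproot t) ≡ just (toY t)
  fromForest-uproot {leaf l}            w             = refl
  fromForest-uproot {node (suc c) ts}   w             = refl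
  fromForest-uproot {node zero []}      (node () _ _)
  fromForest-uproot {node zero (_ ∷ _)} w             = refl

  toY-valid : ∀ {s t} → IsSTree (suc k) s t → CanonicalLabelled s (toY t)
  toY-valid {s} {t} (p , w) with uproot-valid w
  ... | ws , nzs , uproot↭ =
    subst CanonicalM (fromForest-uproot w)
          (CanonicalM-fromForest id (λ e → e) (uproot t) ws nzs (Unique-resp-↭ (↭-sym uproot↭) unique-t))
    , ↭-trans (subst (λ v → ylabelsM v ↭ slabelsL (uproot t)) (fromForest-uproot w)
                     (ylabelsM-fromForest id (λ e → e) (uproot t) ws nzs))
              (↭-trans uproot↭ p)
    where
    unique-t : Unique (slabels t)
    unique-t = Unique-resp-↭ (↭-sym p) (Unique-labelSet s)

  A-count-canonicalTrees : ∀ s → A-count (suc k) s (length (canonicalTrees s))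
  A-count-canonicalTrees s = classCount-fromCanonical (canonicalTrees s) toS (canonicalTrees-unique s)
    (λ {c} c∈ → toS-valid c (proj₂ (∈-canonicalTrees⁻ s c∈)))
    reflect
    (λ t valid → toY t , ∈-canonicalTrees⁺ s (toY-valid valid) , toS-toY (proj₂ valid))
    where
    reflect : ∀ {c d} → c ∈ canonicalTrees s → d ∈ canonicalTrees s → toS c ≅S toS d → c ≡ d
    reflect {c} {d} c∈ d∈ c≅d = begin
      c             ≡⟨ sym (toY-toS (proj₁ c-labelled)) ⟩
      toY (toS c)   ≡⟨ toY-≅S c≅d (DistinctChildMins-valid (toS-valid c (proj₂ c-labelled))) ⟩
      toY (toS d)   ≡⟨ toY-toS (proj₁ (∈-canonicalTrees⁻ s d∈)) ⟩
      d             ∎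
      where
      open ≡.≡-Reasoning
      c-labelled : CanonicalLabelled s c
      c-labelled = ∈-canonicalTrees⁻ s c∈

-- The identity holds for every s, and also for m = 1; the hypotheses only exclude m = 0.
mainTheorem7 : (m s : ℕ) → 2 ≤ m → 1 ≤ s →
    Σ ℕ (λ n → Y-count (m ∸ 1) s n × A-count m s n)
mainTheorem7 (suc k) s _ _ =
  length (canonicalTrees s) , Y-count-canonicalTrees s , Bijection.A-count-canonicalTrees k s
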